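{- Let $A$ be a finite alphabet of colors and let $J$ and $B$ be sentences over $A$. Then $$K_{J,B}=\sum_{C\succeq B}L_{J,C},$$ where the sum runs over all sentences $C$ that are coarsenings of $B$, $K_{J,B}$ is the number of colored immaculate tableaux of shape $J$ and type $B$, and $L_{J,C}$ is the number of standard colored immaculate tableaux of shape $J$ with colored descent composition $C$.
   Context: Words over $A$ are finite sequences of colors; a sentence is a finite sequence of nonempty words. For sentences $I=(w_1,\dots,w_k)$, $J$, write $w(I)=w_1\cdots w_k$; $J\preceq I$ ($I$ is a coarsening of $J$) if $w(J)=w(I)$ and $I$ is obtained from $J$ by concatenating some adjacent words. For a sentence $J=(w_1,\dots,w_k)$ the colored composition diagram of shape $J$ has $k$ left-justified rows (row 1 on top), row $i$ having $|w_i|$ boxes, the $j$-th box of row $i$ colored by the $j$-th letter of $w_i$. A colored immaculate tableau (CIT) of shape $J$ is a filling of the boxes by positive integers, weakly increasing left to right in each row and strictly increasing top to bottom in the first column. Its type is the weak sentence $(u_1,\dots,u_m)$ where $u_i$ is the word of colors of the boxes containing $i$, read row by row from the lowest row to the highest, left to right within each row. A standard CIT (SCIT) of size $n$ is a CIT whose entries are $1,\dots,n$, each once. A SCIT $U$ has a descent at $i$ ($1\le i<n$) if $i+1$ lies in a strictly lower row than $i$. The colored descent composition $co_A(U)$ is the sentence obtained by reading the colors of the boxes in the order of their entries $1,2,\dots,n$ and starting a new word immediately after each descent. -}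

module Defs where

open import Data.Bool using (Bool; true; false; _∧_; if_then_else_)
open import Data.Nat using (ℕ; zero; suc; _⊔_; _≡ᵇ_; _≤ᵇ_; _<ᵇ_)
open import Data.List using (List; []; _∷_; map; concat; concatMap; length; reverse; foldr; applyUpTo; zipWith; zip; filterᵇ; mapMaybe)
open import Data.Nat.ListAction using (sum)
open import Data.Bool.ListAction using () renaming (all to allᵇ)
open import Data.List.NonEmpty using (List⁺; _∷_; toList; _⁺++⁺_)
import Data.List.NonEmpty as L⁺
open import Data.List.Properties using (≡-dec)
open import Data.Maybe using (Maybe; just; nothing)
open import Data.Product using (_×_; _,_; proj₁; proj₂)
open import Relation.Binary.Definitions using (DecidableEquality)
open import Relation.Nullary.Decidable using (⌊_⌋)

Word : Set → Set
Word A = List A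

Sentence : Set → Set
Sentence A = List (List⁺ A)

words : {A : Set} → Sentence A → List (Word A)
words = map toList

shape : {A : Set} → Sentence A → List ℕ
shape = map L⁺.length

size : {A : Set} → Sentence A → ℕ
size J = sum (shape J)

vals : ℕ → List ℕ
vals = applyUpTo suc

-- Fillings: a filling of a diagram is its list of rows (top row first),
-- each row the list of entries from left to right.

Filling : Set
Filling = List (List ℕ)

rowsUpTo : ℕ → ℕ → List (List ℕ)
rowsUpTo N zero    = [] ∷ []
rowsUpTo N (suc ℓ) = concatMap (λ x → map (x ∷_) (rowsUpTo N ℓ)) (vals N)

fillingsUpTo : ℕ → List ℕ → List Filling
fillingsUpTo N []       = [] ∷ []
fillingsUpTo N (ℓ ∷ ls) = concatMap (λ r → map (r ∷_) (fillingsUpTo N ls)) (rowsUpTo N ℓ)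

weakInc : List ℕ → Bool
weakInc []           = true
weakInc (x ∷ [])     = true
weakInc (x ∷ y ∷ xs) = (x ≤ᵇ y) ∧ weakInc (y ∷ xs)

strictInc : List ℕ → Bool
strictInc []           = true
strictInc (x ∷ [])     = true
strictInc (x ∷ y ∷ xs) = (x <ᵇ y) ∧ strictInc (y ∷ xs)

headM : List ℕ → Maybe ℕ
headM []      = nothing
headM (x ∷ _) = just x

firstColumn : Filling → List ℕ
firstColumn = mapMaybe headM

-- immaculate conditions: rows weakly increasing, first column strictly
-- increasing top to bottom (entries are positive by construction)
isImmaculate : Filling → Bool
isImmaculate T = allᵇ weakInc T ∧ strictInc (firstColumn T)

colored : {A : Set} → Sentence A → Filling → List (List (ℕ × A))
colored J T = zipWith zip T (words J)

maxEntry : Filling → ℕ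
maxEntry T = foldr _⊔_ 0 (concat T)

typeWord : {A : Set} → Sentence A → Filling → ℕ → Word A
typeWord J T i =
  concatMap (λ row → map proj₂ (filterᵇ (λ p → proj₁ p ≡ᵇ i) row))
            (reverse (colored J T))

typeOf : {A : Set} → Sentence A → Filling → List (Word A)
typeOf J T = map (typeWord J T) (vals (maxEntry T))

countOcc : ℕ → List ℕ → ℕ
countOcc i xs = length (filterᵇ (λ x → x ≡ᵇ i) xs)

isStandard : {A : Set} → Sentence A → Filling → Bool
isStandard J T = allᵇ (λ i → countOcc i (concat T) ≡ᵇ 1) (vals (size J))

withRows : {A : Set} → ℕ → List (List (ℕ × A)) → List (ℕ × ℕ × A)
withRows r []           = []
withRows r (row ∷ rows) = map (λ p → proj₁ p , r , proj₂ p) row ++' withRows (suc r) rows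
  where
  _++'_ : {B : Set} → List B → List B → List B
  [] ++' ys       = ys
  (x ∷ xs) ++' ys = x ∷ (xs ++' ys)

findEntry : {A : Set} → ℕ → List (ℕ × ℕ × A) → Maybe (ℕ × A)
findEntry i []                  = nothing
findEntry i ((e , r , c) ∷ bs) = if e ≡ᵇ i then just (r , c) else findEntry i bs

readByEntry : {A : Set} → Sentence A → Filling → List (ℕ × A)
readByEntry J T =
  mapMaybe (λ i → findEntry i (withRows 1 (colored J T))) (vals (size J))

addFront : {A : Set} → A → List (Word A) → List (Word A)
addFront c []       = (c ∷ []) ∷ []
addFront c (w ∷ ws) = (c ∷ w) ∷ ws

-- cut the color reading after each descent (i+1 in a strictly lower row)
cutDescents : {A : Set} → List (ℕ × A) → List (Word A)
cutDescents []                   = []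
cutDescents ((r , c) ∷ [])       = (c ∷ []) ∷ []
cutDescents ((r , c) ∷ y ∷ xs)   =
  if r <ᵇ proj₁ y
  then (c ∷ []) ∷ cutDescents (y ∷ xs)
  else addFront c (cutDescents (y ∷ xs))

descentComposition : {A : Set} → Sentence A → Filling → List (Word A)
descentComposition J T = cutDescents (readByEntry J T)

-- Coarsenings: all sentences obtained from B by concatenating some
-- adjacent words (including B itself); each is listed exactly once.

mergeFirst : {A : Set} → List⁺ A → Sentence A → List (Sentence A)
mergeFirst w []       = []
mergeFirst w (c ∷ cs) = ((w ⁺++⁺ c) ∷ cs) ∷ []

coarsenings : {A : Set} → Sentence A → List (Sentence A)
coarsenings []           = [] ∷ []
coarsenings (w ∷ [])     = (w ∷ []) ∷ []
coarsenings (w ∷ v ∷ ws) =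
  concatMap (λ C → (w ∷ C) ∷ mergeFirst w C) (coarsenings (v ∷ ws))

module _ {A : Set} (_≟A_ : DecidableEquality A) where

  sameWords : List (Word A) → List (Word A) → Bool
  sameWords x y = ⌊ ≡-dec (≡-dec _≟A_) x y ⌋

  -- K_{J,B}: number of CITs of shape J and type B.  A CIT of type B has
  -- largest entry = length B, so enumerating entries in {1..length B}
  -- is exhaustive.
  Kcount : Sentence A → Sentence A → ℕ
  Kcount J B = length (filterᵇ
    (λ T → isImmaculate T ∧ sameWords (typeOf J T) (words B))
    (fillingsUpTo (length B) (shape J)))

  Lcount : Sentence A → Sentence A → ℕ
  Lcount J C = length (filterᵇ
    (λ T → isImmaculate T ∧ isStandard J T
           ∧ sameWords (descentComposition J T) (words C))
    (fillingsUpTo (size J) (shape J)))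

-- Number the boxes of a CIT T of shape J and type B = (u₁, …, u_m) by 1, 2, … in the
-- order of the type reading: first the boxes containing 1 (lowest row first, left to right), then those
-- containing 2, and so on.  Rows stay weakly increasing and the first column stays strictly increasing, so
-- this gives a standard CIT U.  Inside one block of equal entries the reading never moves to a strictly
-- lower row, so every descent of U sits at a block boundary: co(U) is a coarsening of B.  Conversely,
-- cutting the reading 1, 2, …, n of a SCIT U whose co(U) coarsens B into runs with colour words
-- u₁, …, u_m gives descent-free runs, and writing i into the i-th run recovers T.  Both fillings are
-- rebuilt from the same list of runs of boxes (row, colour), which is the pivot of the bijection; as the
-- coarsenings of B are pairwise distinct, the sum of the L_{J,C} counts each such U exactly once.

module Submission where

open import Defs
open import Data.Bool using (Bool; true; false; T; T?; _∧_; _∨_)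
open import Data.Bool.ListAction using () renaming (all to allᵇ; any to anyᵇ)
open import Data.Bool.Properties using (T-∧)
open import Data.Empty using (⊥; ⊥-elim)
open import Data.Fin using (Fin)
open import Data.Fin.Properties using (_≟_)
open import Data.List
  using (List; []; _∷_; map; concat; concatMap; length; filterᵇ; applyUpTo; _++_; foldr; reverse; mapMaybe; catMaybes;
         zip; take; drop; cartesianProductWith; head)
open import Data.List.Properties
  using (∷-injective; ∷-injectiveˡ; ∷-injectiveʳ; ++-identityʳ; ++-identityʳ-unique; ++-cancelˡ; length-++; length-map;
         length-applyUpTo; map-++; mapMaybe-map; map-mapMaybe; map-∘; map-id; map-cong-local; concat-map; concat-++; unfold-reverse; reverse-++; reverse-map;
         filter-accept; filter-reject; filter-++; filter-none; filter-all)
open import Data.List.NonEmpty using (List⁺; _∷_; toList)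
import Data.List.NonEmpty as List⁺
open import Data.List.Membership.Propositional using (_∈_)
open import Data.List.Membership.Propositional.Properties
  using (∈-concat⁺′; ∈-concat⁻′; ∈-cartesianProductWith⁺; ∈-cartesianProductWith⁻; ∈-filter⁻; ∈-filter⁺;
         ∈-∃++; ∈-++⁻; ∈-++⁺ˡ; ∈-++⁺ʳ; ∈-map⁺; ∈-map⁻)
open import Data.List.Relation.Unary.All using (All; []; _∷_)
import Data.List.Relation.Unary.All as All
import Data.List.Relation.Unary.All.Properties as AllP
open import Data.List.Relation.Unary.AllPairs using (AllPairs; []; _∷_)
import Data.List.Relation.Unary.AllPairs as AllPairs
import Data.List.Relation.Unary.AllPairs.Properties as APP
open import Data.List.Relation.Unary.Any using (here; there)
import Data.List.Relation.Unary.Any.Properties as Any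
open import Data.List.Relation.Unary.Linked using (Linked; []; [-]; _∷_)
import Data.List.Relation.Unary.Linked.Properties as LP
open import Data.List.Relation.Unary.Unique.Propositional using (Unique)
import Data.List.Relation.Unary.Unique.Propositional.Properties as Unique
open import Data.List.Relation.Binary.Disjoint.Propositional using (Disjoint)
open import Data.List.Relation.Binary.Permutation.Propositional using (_↭_; ↭-reflexive; ↭-sym; ↭-trans; prep)
open import Data.List.Relation.Binary.Permutation.Propositional.Properties
  using (shift; ++⁺ˡ; filter-↭; map⁺; ↭-length; ↭-singleton-inv; All-resp-↭; ∈-resp-↭)
open import Data.Maybe using (Maybe; just; nothing)
import Data.Maybe as Maybe
open import Data.Nat using (ℕ; zero; suc; _+_; _≤_; _<_; z≤n; s≤s; _≡ᵇ_; _≤ᵇ_; _<ᵇ_; _⊔_)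
open import Data.Nat.Properties hiding (_≟_)
import Data.Nat.Properties as ℕ
open import Data.Nat.ListAction using (sum)
open import Data.Product using (_×_; _,_; proj₁; proj₂; ∃)
open import Data.Sum using (_⊎_; inj₁; inj₂)
open import Data.Unit using (tt)
open import Function using (_∘_; id)
open import Function.Bundles using (Equivalence)
open import Relation.Binary.Definitions using (DecidableEquality)
open import Relation.Binary.PropositionalEquality
open import Relation.Nullary using (¬_; yes; no)
open import Relation.Nullary.Decidable using (fromWitness; toWitness)

filterᵇ-comm : ∀ {X : Set} (p q : X → Bool) xs → filterᵇ p (filterᵇ q xs) ≡ filterᵇ q (filterᵇ p xs)
filterᵇ-comm p q [] = refl
filterᵇ-comm p q (x ∷ xs) with p x in ep | q x in eq
... | true  | true  rewrite ep | eq = cong (x ∷_) (filterᵇ-comm p q xs)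
... | true  | false rewrite eq = filterᵇ-comm p q xs
... | false | true  rewrite ep = filterᵇ-comm p q xs
... | false | false = filterᵇ-comm p q xs

filterᵇ-map : ∀ {X Y : Set} (p : Y → Bool) (f : X → Y) xs → filterᵇ p (map f xs) ≡ map f (filterᵇ (p ∘ f) xs)
filterᵇ-map p f [] = refl
filterᵇ-map p f (x ∷ xs) with p (f x)
... | true = cong (f x ∷_) (filterᵇ-map p f xs)
... | false = filterᵇ-map p f xs

filterᵇ-concat : ∀ {X : Set} (p : X → Bool) xss → filterᵇ p (concat xss) ≡ concat (map (filterᵇ p) xss)
filterᵇ-concat p [] = refl
filterᵇ-concat p (xs ∷ xss) = trans (filter-++ (T? ∘ p) xs (concat xss)) (cong (filterᵇ p xs ++_) (filterᵇ-concat p xss))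

filterᵇ-cong-local : ∀ {X : Set} (p q : X → Bool) xs → All (λ x → p x ≡ q x) xs → filterᵇ p xs ≡ filterᵇ q xs
filterᵇ-cong-local p q [] [] = refl
filterᵇ-cong-local p q (x ∷ xs) (e ∷ es) with p x | q x
filterᵇ-cong-local p q (x ∷ xs) (refl ∷ es) | true | true = cong (x ∷_) (filterᵇ-cong-local p q xs es)
filterᵇ-cong-local p q (x ∷ xs) (refl ∷ es) | false | false = filterᵇ-cong-local p q xs es

range : ℕ → ℕ → List ℕ
range s zero = []
range s (suc m) = s ∷ range (suc s) m

applyUpTo≡range : ∀ (f : ℕ → ℕ) s m → (∀ i → f i ≡ s + i) → applyUpTo f m ≡ range s m
applyUpTo≡range f s zero h = refl
applyUpTo≡range f s (suc m) h = cong₂ _∷_ (trans (h 0) (+-identityʳ s))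
  (applyUpTo≡range (f ∘ suc) (suc s) m (λ i → trans (h (suc i)) (+-suc s i)))

vals≡range : ∀ m → vals m ≡ range 1 m
vals≡range m = applyUpTo≡range suc 1 m (λ i → refl)

∈-range⁻ : ∀ {v} s m → v ∈ range s m → s ≤ v × v < s + m
∈-range⁻ s (suc m) (here refl) = ≤-refl , m<m+n s {suc m} (s≤s z≤n)
∈-range⁻ {v} s (suc m) (there p) = let (a , b) = ∈-range⁻ (suc s) m p in ≤-trans (n≤1+n s) a , subst (v <_) (sym (+-suc s m)) b

∈-range⁺ : ∀ {v} s m → s ≤ v → v < s + m → v ∈ range s m
∈-range⁺ {v} s zero a b = ⊥-elim (<-irrefl refl (≤-trans b (subst (_≤ v) (sym (+-identityʳ s)) a)))
∈-range⁺ {v} s (suc m) a b with m≤n⇒m<n∨m≡n a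
... | inj₂ refl = here refl
... | inj₁ s<v = there (∈-range⁺ (suc s) m s<v (subst (v <_) (+-suc s m) b))

range-∷ʳ : ∀ s m → range s (suc m) ≡ range s m ++ (s + m) ∷ []
range-∷ʳ s zero = cong (_∷ []) (sym (+-identityʳ s))
range-∷ʳ s (suc m) = cong (s ∷_) (trans (range-∷ʳ (suc s) m) (cong (λ t → range (suc s) m ++ t ∷ []) (sym (+-suc s m))))

reverse-range : ∀ s m → reverse (range s (suc m)) ≡ (s + m) ∷ reverse (range s m)
reverse-range s m = trans (cong reverse (range-∷ʳ s m)) (reverse-++ (range s m) ((s + m) ∷ []))

module Fibres {X : Set} (κ : X → ℕ) where

  fibre : ℕ → List X → List X
  fibre v = filterᵇ (λ x → κ x ≡ᵇ v)

  fibres : List ℕ → List X → List X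
  fibres vs L = concat (map (λ v → fibre v L) vs)

  fibres-[] : ∀ vs → fibres vs [] ≡ []
  fibres-[] [] = refl
  fibres-[] (_ ∷ vs) = fibres-[] vs

  fibre-∷-≡ : ∀ {v} x L → κ x ≡ v → fibre v (x ∷ L) ≡ x ∷ fibre v L
  fibre-∷-≡ {v} x L e = filter-accept (T? ∘ (λ y → κ y ≡ᵇ v)) {xs = L} (≡⇒≡ᵇ (κ x) v e)

  fibre-∷-≢ : ∀ {v} x L → κ x ≢ v → fibre v (x ∷ L) ≡ fibre v L
  fibre-∷-≢ {v} x L ne = filter-reject (T? ∘ (λ y → κ y ≡ᵇ v)) {xs = L} (λ t → ne (≡ᵇ⇒≡ (κ x) v t))

  fibre-none : ∀ v L → All (λ y → κ y ≢ v) L → fibre v L ≡ []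
  fibre-none v [] [] = refl
  fibre-none v (x ∷ L) (ne ∷ h) = trans (fibre-∷-≢ x L ne) (fibre-none v L h)

  fibres-∷-∉ : ∀ x L vs → All (κ x ≢_) vs → fibres vs (x ∷ L) ≡ fibres vs L
  fibres-∷-∉ x L vs h = cong concat (map-cong-local (All.map (fibre-∷-≢ x L) h))

  fibres-∷-head : ∀ x L v vs → κ x ≡ v → All (κ x ≢_) vs → fibres (v ∷ vs) (x ∷ L) ≡ x ∷ fibres (v ∷ vs) L
  fibres-∷-head x L v vs e h = cong₂ _++_ (fibre-∷-≡ x L e) (fibres-∷-∉ x L vs h)

  fibres-range-ascending : ∀ s m (L : List X) → AllPairs (λ x y → κ x ≤ κ y) L →
    All (λ x → s ≤ κ x × κ x < s + m) L → fibres (range s m) L ≡ L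
  fibres-range-ascending s zero [] _ _ = refl
  fibres-range-ascending s zero (x ∷ L) _ ((s≤ , <s+0) ∷ _) = ⊥-elim (<⇒≱ <s+0 (subst (_≤ κ x) (sym (+-identityʳ s)) s≤))
  fibres-range-ascending s (suc m) = go
    where
    go : ∀ L → AllPairs (λ x y → κ x ≤ κ y) L → All (λ x → s ≤ κ x × κ x < s + suc m) L → fibres (range s (suc m)) L ≡ L
    go [] _ _ = fibres-[] (range s (suc m))
    go (x ∷ L) (x≤L ∷ sorted) ((s≤x , x<) ∷ bounds) with m≤n⇒m<n∨m≡n s≤x
    ... | inj₂ e = trans (fibres-∷-head x L s (range (suc s) m) (sym e)
                           (All.tabulate (λ v∈ e' → <-irrefl (trans e e') (proj₁ (∈-range⁻ (suc s) m v∈)))))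
                         (cong (x ∷_) (go L sorted bounds))
    ... | inj₁ s<x = trans (cong (_++ fibres (range (suc s) m) (x ∷ L)) (fibre-none s (x ∷ L) (All.map (λ lt e → <⇒≢ lt (sym e)) above)))
                           (fibres-range-ascending (suc s) m (x ∷ L) (x≤L ∷ sorted) (narrow above ((s≤x , x<) ∷ bounds)))
      where
      above : All (λ y → s < κ y) (x ∷ L)
      above = s<x ∷ All.map (<-≤-trans s<x) x≤L
      narrow : ∀ {ys} → All (λ y → s < κ y) ys → All (λ y → s ≤ κ y × κ y < s + suc m) ys → All (λ y → suc s ≤ κ y × κ y < suc s + m) ys
      narrow [] [] = []
      narrow {y ∷ _} (lt ∷ lts) ((_ , <s+) ∷ bs) = (lt , subst (κ y <_) (+-suc s m) <s+) ∷ narrow lts bs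

  fibres-range-descending : ∀ s m (L : List X) → AllPairs (λ x y → κ y ≤ κ x) L →
    All (λ x → s ≤ κ x × κ x < s + m) L → fibres (reverse (range s m)) L ≡ L
  fibres-range-descending s zero [] _ _ = refl
  fibres-range-descending s zero (x ∷ L) _ ((s≤ , <s+0) ∷ _) = ⊥-elim (<⇒≱ <s+0 (subst (_≤ κ x) (sym (+-identityʳ s)) s≤))
  fibres-range-descending s (suc m) L sorted bounds = trans (cong (λ vs → fibres vs L) (reverse-range s m)) (go L sorted bounds)
    where
    go : ∀ L → AllPairs (λ x y → κ y ≤ κ x) L → All (λ x → s ≤ κ x × κ x < s + suc m) L →
      fibres ((s + m) ∷ reverse (range s m)) L ≡ L
    go [] _ _ = fibres-[] ((s + m) ∷ reverse (range s m))
    go (x ∷ L) (L≤x ∷ sorted) ((s≤x , x<) ∷ bounds) with m≤n⇒m<n∨m≡n (≤-pred (subst (κ x <_) (+-suc s m) x<))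
    ... | inj₂ e = trans (fibres-∷-head x L (s + m) (reverse (range s m)) e
                           (All.tabulate (λ v∈ e' → <-irrefl (trans (sym e') e)
                             (proj₂ (∈-range⁻ s m (Any.reverse⁻ v∈))))))
                         (cong (x ∷_) (go L sorted bounds))
    ... | inj₁ x<top = trans (cong (_++ fibres (reverse (range s m)) (x ∷ L)) (fibre-none (s + m) (x ∷ L) (All.map <⇒≢ below)))
                             (fibres-range-descending s m (x ∷ L) (L≤x ∷ sorted) (narrow below ((s≤x , x<) ∷ bounds)))
      where
      below : All (λ y → κ y < s + m) (x ∷ L)
      below = x<top ∷ All.map (λ y≤x → ≤-<-trans y≤x x<top) L≤x
      narrow : ∀ {ys} → All (λ y → κ y < s + m) ys → All (λ y → s ≤ κ y × κ y < s + suc m) ys → All (λ y → s ≤ κ y × κ y < s + m) ys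
      narrow [] [] = []
      narrow (lt ∷ lts) ((s≤ , _) ∷ bs) = (s≤ , lt) ∷ narrow lts bs

  fibres-∷-↭ : ∀ x L vs → κ x ∈ vs → Unique vs → fibres vs (x ∷ L) ↭ x ∷ fibres vs L
  fibres-∷-↭ x L (v ∷ vs) (here e) (v∉vs ∷ _) =
    ↭-reflexive (fibres-∷-head x L v vs e (subst (λ w → All (w ≢_) vs) (sym e) v∉vs))
  fibres-∷-↭ x L (v ∷ vs) (there m) (v∉vs ∷ u) =
    ↭-trans (↭-reflexive (cong (_++ fibres vs (x ∷ L)) (fibre-∷-≢ x L (λ e → All.lookup v∉vs m (sym e)))))
      (↭-trans (++⁺ˡ (fibre v L) (fibres-∷-↭ x L vs m u)) (shift x (fibre v L) _))

  fibres-↭ : ∀ (L : List X) vs → All (λ x → κ x ∈ vs) L → Unique vs → fibres vs L ↭ L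
  fibres-↭ [] vs _ _ = ↭-reflexive (fibres-[] vs)
  fibres-↭ (x ∷ L) vs (m ∷ ms) u = ↭-trans (fibres-∷-↭ x L vs m u) (prep x (fibres-↭ L vs ms u))

Unique-⊆⇒length≤ : ∀ {X : Set} (zs ws : List X) → Unique zs → (∀ {z} → z ∈ zs → z ∈ ws) → length zs ≤ length ws
Unique-⊆⇒length≤ [] ws u h = z≤n
Unique-⊆⇒length≤ (z ∷ zs) ws (z∉zs ∷ u) h with ws₁ , ws₂ , refl ← ∈-∃++ (h (here refl)) =
  subst (suc (length zs) ≤_) (sym length-split) (s≤s (Unique-⊆⇒length≤ zs (ws₁ ++ ws₂) u ⊆-rest))
  where
  length-split : length (ws₁ ++ z ∷ ws₂) ≡ suc (length (ws₁ ++ ws₂))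
  length-split = trans (length-++ ws₁) (trans (+-suc (length ws₁) (length ws₂)) (cong suc (sym (length-++ ws₁))))
  ⊆-rest : ∀ {y} → y ∈ zs → y ∈ ws₁ ++ ws₂
  ⊆-rest m with ∈-++⁻ ws₁ (h (there m))
  ... | inj₁ m₁ = ∈-++⁺ˡ m₁
  ... | inj₂ (here refl) = ⊥-elim (All.lookup z∉zs m refl)
  ... | inj₂ (there m₂) = ∈-++⁺ʳ ws₁ m₂

Unique-map⁺-local : ∀ {X Y : Set} (f : X → Y) zs → Unique zs →
  (∀ {x y} → x ∈ zs → y ∈ zs → f x ≡ f y → x ≡ y) → Unique (map f zs)
Unique-map⁺-local f [] u inj = []
Unique-map⁺-local f (z ∷ zs) (z∉zs ∷ u) inj =
  AllP.map⁺ (All.tabulate (λ m e → All.lookup z∉zs m (inj (here refl) (there m) e)))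
  ∷ Unique-map⁺-local f zs u (λ a b → inj (there a) (there b))

count-≤-by-injection : ∀ {X Y : Set} (xs : List X) (ys : List Y) (p : X → Bool) (q : Y → Bool) → Unique xs →
  (f : X → Y) (g : Y → X) →
  (∀ {x} → x ∈ xs → T (p x) → f x ∈ ys × T (q (f x)) × g (f x) ≡ x) →
  length (filterᵇ p xs) ≤ length (filterᵇ q ys)
count-≤-by-injection xs ys p q u f g h =
  subst (_≤ length (filterᵇ q ys)) (length-map f (filterᵇ p xs))
    (Unique-⊆⇒length≤ (map f (filterᵇ p xs)) (filterᵇ q ys)
      (Unique-map⁺-local f _ (Unique.filter⁺ (T? ∘ p) u) injective) image⊆)
  where
  injective : ∀ {x y} → x ∈ filterᵇ p xs → y ∈ filterᵇ p xs → f x ≡ f y → x ≡ y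
  injective mx my e with mx' , px ← ∈-filter⁻ (T? ∘ p) mx | my' , py ← ∈-filter⁻ (T? ∘ p) my =
    trans (sym (proj₂ (proj₂ (h mx' px)))) (trans (cong g e) (proj₂ (proj₂ (h my' py))))
  image⊆ : ∀ {z} → z ∈ map f (filterᵇ p xs) → z ∈ filterᵇ q ys
  image⊆ m with x , mx , refl ← ∈-map⁻ f m with mx' , px ← ∈-filter⁻ (T? ∘ p) mx =
    let (fx∈ys , qfx , _) = h mx' px in ∈-filter⁺ (T? ∘ q) fx∈ys qfx

count-≡-by-bijection : ∀ {X Y : Set} (xs : List X) (ys : List Y) (p : X → Bool) (q : Y → Bool) → Unique xs → Unique ys →
  (f : X → Y) (g : Y → X) →
  (∀ {x} → x ∈ xs → T (p x) → f x ∈ ys × T (q (f x)) × g (f x) ≡ x) →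
  (∀ {y} → y ∈ ys → T (q y) → g y ∈ xs × T (p (g y)) × f (g y) ≡ y) →
  length (filterᵇ p xs) ≡ length (filterᵇ q ys)
count-≡-by-bijection xs ys p q ux uy f g f-inj g-inj =
  ≤-antisym (count-≤-by-injection xs ys p q ux f g f-inj) (count-≤-by-injection ys xs q p uy g f g-inj)

length-filterᵇ-↭ : ∀ {X : Set} (p : X → Bool) {xs ys} → xs ↭ ys → length (filterᵇ p xs) ≡ length (filterᵇ p ys)
length-filterᵇ-↭ p pr = ↭-length (filter-↭ (T? ∘ p) pr)

concatMap-map≡cartesianProductWith : ∀ {X Y Z : Set} (h : X → Y → Z) xs ys →
  concatMap (λ x → map (h x) ys) xs ≡ cartesianProductWith h xs ys
concatMap-map≡cartesianProductWith h [] ys = refl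
concatMap-map≡cartesianProductWith h (x ∷ xs) ys = cong (map (h x) ys ++_) (concatMap-map≡cartesianProductWith h xs ys)

rowsUpTo-suc : ∀ N ℓ → rowsUpTo N (suc ℓ) ≡ cartesianProductWith _∷_ (vals N) (rowsUpTo N ℓ)
rowsUpTo-suc N ℓ = concatMap-map≡cartesianProductWith _∷_ (vals N) (rowsUpTo N ℓ)

fillingsUpTo-∷ : ∀ N ℓ ls → fillingsUpTo N (ℓ ∷ ls) ≡ cartesianProductWith _∷_ (rowsUpTo N ℓ) (fillingsUpTo N ls)
fillingsUpTo-∷ N ℓ ls = concatMap-map≡cartesianProductWith _∷_ (rowsUpTo N ℓ) (fillingsUpTo N ls)

vals-unique : ∀ N → Unique (vals N)
vals-unique N = Unique.applyUpTo⁺₁ suc N (λ i<j _ → <⇒≢ (s≤s i<j))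

rowsUpTo-unique : ∀ N ℓ → Unique (rowsUpTo N ℓ)
rowsUpTo-unique N zero = [] ∷ []
rowsUpTo-unique N (suc ℓ) = subst Unique (sym (rowsUpTo-suc N ℓ))
  (Unique.cartesianProductWith⁺ _∷_ ∷-injective (vals-unique N) (rowsUpTo-unique N ℓ))

fillingsUpTo-unique : ∀ N ls → Unique (fillingsUpTo N ls)
fillingsUpTo-unique N [] = [] ∷ []
fillingsUpTo-unique N (ℓ ∷ ls) = subst Unique (sym (fillingsUpTo-∷ N ℓ ls))
  (Unique.cartesianProductWith⁺ _∷_ ∷-injective (rowsUpTo-unique N ℓ) (fillingsUpTo-unique N ls))

InVals : ℕ → ℕ → Set
InVals N x = 1 ≤ x × x ≤ N

∈-vals⁻ : ∀ N {x} → x ∈ vals N → InVals N x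
∈-vals⁻ N m = let (a , b) = ∈-range⁻ 1 N (subst (_ ∈_) (vals≡range N) m) in a , ≤-pred b

∈-vals⁺ : ∀ N {x} → InVals N x → x ∈ vals N
∈-vals⁺ N (a , b) = subst (_ ∈_) (sym (vals≡range N)) (∈-range⁺ 1 N a (s≤s b))

∈-rowsUpTo⁻ : ∀ N ℓ {r} → r ∈ rowsUpTo N ℓ → length r ≡ ℓ × All (InVals N) r
∈-rowsUpTo⁻ N zero (here refl) = refl , []
∈-rowsUpTo⁻ N (suc ℓ) m
  with x , r , mx , mr , refl ← ∈-cartesianProductWith⁻ _∷_ (vals N) (rowsUpTo N ℓ) (subst (_ ∈_) (rowsUpTo-suc N ℓ) m) =
  let (a , b) = ∈-rowsUpTo⁻ N ℓ mr in cong suc a , ∈-vals⁻ N mx ∷ b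

∈-rowsUpTo⁺ : ∀ N ℓ r → length r ≡ ℓ → All (InVals N) r → r ∈ rowsUpTo N ℓ
∈-rowsUpTo⁺ N zero [] refl [] = here refl
∈-rowsUpTo⁺ N (suc ℓ) (x ∷ r) refl (i ∷ is) = subst (_ ∈_) (sym (rowsUpTo-suc N ℓ))
  (∈-cartesianProductWith⁺ _∷_ (∈-vals⁺ N i) (∈-rowsUpTo⁺ N ℓ r refl is))

∈-fillingsUpTo⁻ : ∀ N ls {T} → T ∈ fillingsUpTo N ls → map length T ≡ ls × All (All (InVals N)) T
∈-fillingsUpTo⁻ N [] (here refl) = refl , []
∈-fillingsUpTo⁻ N (ℓ ∷ ls) m
  with r , T , mr , mT , refl ← ∈-cartesianProductWith⁻ _∷_ (rowsUpTo N ℓ) (fillingsUpTo N ls) (subst (_ ∈_) (fillingsUpTo-∷ N ℓ ls) m) =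
  let (a , b) = ∈-rowsUpTo⁻ N ℓ mr ; (c , d) = ∈-fillingsUpTo⁻ N ls mT in cong₂ _∷_ a c , b ∷ d

∈-fillingsUpTo⁺ : ∀ N ls T → map length T ≡ ls → All (All (InVals N)) T → T ∈ fillingsUpTo N ls
∈-fillingsUpTo⁺ N [] [] refl [] = here refl
∈-fillingsUpTo⁺ N (ℓ ∷ ls) (r ∷ T) e (i ∷ is) = let (a , b) = ∷-injective e in
  subst (_ ∈_) (sym (fillingsUpTo-∷ N ℓ ls))
    (∈-cartesianProductWith⁺ _∷_ (∈-rowsUpTo⁺ N ℓ r a i) (∈-fillingsUpTo⁺ N ls T b is))

module _ {A : Set} where

  mergeHead : Word A → List (Word A) → List (List (Word A))
  mergeHead u [] = []
  mergeHead u (d ∷ ds) = ((u ++ d) ∷ ds) ∷ []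

  prefixings : Word A → List (Word A) → List (List (Word A))
  prefixings u D = (u ∷ D) ∷ mergeHead u D

  NonEmptyWords : List (Word A) → Set
  NonEmptyWords = All (_≢ [])

  coarseningWords : Sentence A → List (List (Word A))
  coarseningWords B = map words (coarsenings B)

  coarseningWords-∷∷ : ∀ (w v : List⁺ A) ws →
    coarseningWords (w ∷ v ∷ ws) ≡ concatMap (prefixings (toList w)) (coarseningWords (v ∷ ws))
  coarseningWords-∷∷ w@(x ∷ xs) v ws = go (coarsenings (v ∷ ws))
    where
    go : ∀ Cs → map words (concatMap (λ C → (w ∷ C) ∷ mergeFirst w C) Cs) ≡ concatMap (prefixings (toList w)) (map words Cs)
    go [] = refl
    go ([] ∷ Cs) = cong ((toList w ∷ []) ∷_) (go Cs)
    go (((y ∷ ys) ∷ cs) ∷ Cs) = cong (λ t → (toList w ∷ words ((y ∷ ys) ∷ cs)) ∷ ((x ∷ (xs ++ y ∷ ys)) ∷ words cs) ∷ t) (go Cs)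

  words-nonEmpty : ∀ (C : Sentence A) → NonEmptyWords (words C)
  words-nonEmpty [] = []
  words-nonEmpty ((x ∷ xs) ∷ C) = (λ ()) ∷ words-nonEmpty C

  coarseningWords-nonEmpty : ∀ B {D} → D ∈ coarseningWords B → NonEmptyWords D
  coarseningWords-nonEmpty B m with C , _ , refl ← ∈-map⁻ words m = words-nonEmpty C

  coarseningWords-≢[] : ∀ (v : List⁺ A) ws {D} → D ∈ coarseningWords (v ∷ ws) → D ≢ []
  coarseningWords-≢[] v [] (here refl) = λ ()
  coarseningWords-≢[] w (v ∷ ws) m rewrite coarseningWords-∷∷ w v ws = go (coarseningWords (v ∷ ws)) m
    where
    go : ∀ Ds {D} → D ∈ concatMap (prefixings (toList w)) Ds → D ≢ []
    go (D ∷ Ds) m with ∈-++⁻ (prefixings (toList w) D) m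
    go (D ∷ Ds) m | inj₁ (here refl) = λ ()
    go ((d ∷ ds) ∷ Ds) m | inj₁ (there (here refl)) = λ ()
    go (D ∷ Ds) m | inj₂ m' = go Ds m'

  ∈-concatMap-prefixings⁻ : ∀ u Ds {V} → V ∈ concatMap (prefixings u) Ds →
    ∃ λ D → D ∈ Ds × (V ≡ u ∷ D ⊎ ∃ λ d → ∃ λ ds → D ≡ d ∷ ds × V ≡ (u ++ d) ∷ ds)
  ∈-concatMap-prefixings⁻ u (D ∷ Ds) m with ∈-++⁻ (prefixings u D) m
  ... | inj₁ (here refl) = D , here refl , inj₁ refl
  ∈-concatMap-prefixings⁻ u ((d ∷ ds) ∷ Ds) m | inj₁ (there (here refl)) = _ , here refl , inj₂ (d , ds , refl , refl)
  ... | inj₂ m' = let (D' , mD , e) = ∈-concatMap-prefixings⁻ u Ds m' in D' , there mD , e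

  u≢u++d : ∀ (u d : Word A) → d ≢ [] → u ≢ u ++ d
  u≢u++d u d d≢[] e = d≢[] (++-identityʳ-unique u e)

  prefixings-unique : ∀ u D → NonEmptyWords D → Unique (prefixings u D)
  prefixings-unique u [] _ = [] ∷ []
  prefixings-unique u (d ∷ ds) (d≢[] ∷ _) = ((λ e → u≢u++d u d d≢[] (∷-injectiveˡ e)) ∷ []) ∷ [] ∷ []

  prefixings-disjoint : ∀ u {D} Ds → All (D ≢_) Ds → NonEmptyWords D → (∀ {D'} → D' ∈ Ds → NonEmptyWords D') →
    Disjoint (prefixings u D) (concatMap (prefixings u) Ds)
  prefixings-disjoint u Ds D∉Ds ne ne-Ds (here refl , m) with ∈-concatMap-prefixings⁻ u Ds m
  ... | D' , mD' , inj₁ e = All.lookup D∉Ds mD' (∷-injectiveʳ e)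
  ... | D' , mD' , inj₂ (d , ds , refl , e) = u≢u++d u d (All.lookup (ne-Ds mD') (here refl)) (∷-injectiveˡ e)
  prefixings-disjoint u {d ∷ ds} Ds D∉Ds (d≢[] ∷ _) ne-Ds (there (here refl) , m) with ∈-concatMap-prefixings⁻ u Ds m
  ... | D' , mD' , inj₁ e = u≢u++d u d d≢[] (sym (∷-injectiveˡ e))
  ... | D' , mD' , inj₂ (d' , ds' , refl , e) =
    All.lookup D∉Ds mD' (cong₂ _∷_ (++-cancelˡ u d d' (∷-injectiveˡ e)) (∷-injectiveʳ e))

  concatMap-prefixings-unique : ∀ u Ds → Unique Ds → (∀ {D} → D ∈ Ds → NonEmptyWords D) →
    Unique (concatMap (prefixings u) Ds)
  concatMap-prefixings-unique u [] _ _ = []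
  concatMap-prefixings-unique u (D ∷ Ds) (D∉Ds ∷ uDs) ne =
    Unique.++⁺ (prefixings-unique u D (ne (here refl))) (concatMap-prefixings-unique u Ds uDs (ne ∘ there))
      (prefixings-disjoint u Ds D∉Ds (ne (here refl)) (ne ∘ there))

  coarseningWords-unique : ∀ B → Unique (coarseningWords B)
  coarseningWords-unique [] = [] ∷ []
  coarseningWords-unique (w ∷ []) = [] ∷ []
  coarseningWords-unique (w ∷ v ∷ ws) = subst Unique (sym (coarseningWords-∷∷ w v ws))
    (concatMap-prefixings-unique (toList w) (coarseningWords (v ∷ ws)) (coarseningWords-unique (v ∷ ws)) (coarseningWords-nonEmpty (v ∷ ws)))

T-∧ˡ : ∀ {a b} → T (a ∧ b) → T a
T-∧ˡ {a} {b} = proj₁ ∘ Equivalence.to (T-∧ {a} {b})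

T-∧ʳ : ∀ {a b} → T (a ∧ b) → T b
T-∧ʳ {a} {b} = proj₂ ∘ Equivalence.to (T-∧ {a} {b})

T-∧⁺ : ∀ {a b} → T a → T b → T (a ∧ b)
T-∧⁺ {a} {b} ta tb = Equivalence.from (T-∧ {a} {b}) (ta , tb)

anyᵇ⁻ : ∀ {C : Set} (p : C → Bool) cs → T (anyᵇ p cs) → ∃ λ c → c ∈ cs × T (p c)
anyᵇ⁻ p (c ∷ cs) t with p c in e
... | true = c , here refl , subst T (sym e) tt
... | false = let (c' , m , t') = anyᵇ⁻ p cs t in c' , there m , t'

anyᵇ⁺ : ∀ {C : Set} (p : C → Bool) cs {c} → c ∈ cs → T (p c) → T (anyᵇ p cs)
anyᵇ⁺ p (c ∷ cs) (here refl) t with p c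
... | true = tt
anyᵇ⁺ p (c ∷ cs) (there m) t with p c
... | true = tt
... | false = anyᵇ⁺ p cs m t

length-filterᵇ-∨ : ∀ {X : Set} (p q : X → Bool) xs → (∀ x → T (p x) → T (q x) → ⊥) →
  length (filterᵇ (λ x → p x ∨ q x) xs) ≡ length (filterᵇ p xs) + length (filterᵇ q xs)
length-filterᵇ-∨ p q [] d = refl
length-filterᵇ-∨ p q (x ∷ xs) d with p x in ep | q x in eq
... | true | true = ⊥-elim (d x (subst T (sym ep) tt) (subst T (sym eq) tt))
... | true | false = cong suc (length-filterᵇ-∨ p q xs d)
... | false | true = trans (cong suc (length-filterᵇ-∨ p q xs d)) (sym (+-suc _ _))
... | false | false = length-filterᵇ-∨ p q xs d

sum-count≡count-any : ∀ {X C W : Set} (a b : X → Bool) (d : X → W) (K : C → W) (eqW : W → W → Bool)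
  (sound : ∀ x y → T (eqW x y) → x ≡ y) (xs : List X) (Cs : List C) → Unique (map K Cs) →
  sum (map (λ c → length (filterᵇ (λ x → a x ∧ (b x ∧ eqW (d x) (K c))) xs)) Cs)
   ≡ length (filterᵇ (λ x → a x ∧ (b x ∧ anyᵇ (λ c → eqW (d x) (K c)) Cs)) xs)
sum-count≡count-any a b d K eqW sound xs [] u = sym (cong length (filter-none (T? ∘ _) {xs = xs} (All.tabulate {xs = xs} (λ {x} _ → ∧-false (a x) (b x)))))
  where ∧-false : ∀ a b → T (a ∧ (b ∧ false)) → ⊥
        ∧-false true true ()
sum-count≡count-any a b d K eqW sound xs (c ∷ Cs) (nc ∷ u) =
  trans (cong (length (filterᵇ P xs) +_) (sum-count≡count-any a b d K eqW sound xs Cs u))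
  (trans (sym (length-filterᵇ-∨ P Q xs disj)) (cong length (filterᵇ-cong-local _ _ xs (All.tabulate {xs = xs} (λ {x} _ → distr (a x) (b x))))))
  where
  P = λ x → a x ∧ (b x ∧ eqW (d x) (K c))
  Q = λ x → a x ∧ (b x ∧ anyᵇ (λ c → eqW (d x) (K c)) Cs)
  distr : ∀ a b {e f} → (a ∧ (b ∧ e)) ∨ (a ∧ (b ∧ f)) ≡ a ∧ (b ∧ (e ∨ f))
  distr true true = refl
  distr true false = refl
  distr false b = refl
  disj : ∀ x → T (P x) → T (Q x) → ⊥
  disj x tp tq = let (c' , m , t) = anyᵇ⁻ _ Cs (T-∧ʳ (T-∧ʳ {a x} tq))
                     e1 = sound _ _ (T-∧ʳ (T-∧ʳ {a x} tp))
                     e2 = sound _ _ t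
                 in All.lookup nc (∈-map⁺ K m) (trans (sym e1) e2)

∷≢[] : ∀ {X : Set} {x : X} {l : List X} → _≢_ {A = List X} (x ∷ l) []
∷≢[] ()

module _ {A : Set} where

  toList≢[] : ∀ (w : List⁺ A) → toList w ≢ []
  toList≢[] (_ ∷ _) ()

  NoDescent : List (ℕ × A) → Set
  NoDescent = Linked (λ x y → proj₁ y ≤ proj₁ x)

  addFront≢[] : ∀ (c : A) W → addFront c W ≢ []
  addFront≢[] c [] ()
  addFront≢[] c (_ ∷ _) ()

  cutDescents-∷≢[] : ∀ (x : ℕ × A) xs → cutDescents (x ∷ xs) ≢ []
  cutDescents-∷≢[] x [] ()
  cutDescents-∷≢[] (r , c) (y ∷ xs) with r <ᵇ proj₁ y
  ... | true = λ ()
  ... | false = addFront≢[] c (cutDescents (y ∷ xs))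

  cutDescents≡[]⇒≡[] : ∀ (Z : List (ℕ × A)) → cutDescents Z ≡ [] → Z ≡ []
  cutDescents≡[]⇒≡[] [] _ = refl
  cutDescents≡[]⇒≡[] (x ∷ Z) e = ⊥-elim (cutDescents-∷≢[] x Z e)

  cutDescents-ascent : ∀ r (c : A) y xs → ¬ T (r <ᵇ proj₁ y) →
    cutDescents ((r , c) ∷ y ∷ xs) ≡ addFront c (cutDescents (y ∷ xs))
  cutDescents-ascent r c y xs t with r <ᵇ proj₁ y
  ... | true = ⊥-elim (t tt)
  ... | false = refl

  ≤⇒¬descent : ∀ r (y : ℕ × A) → proj₁ y ≤ r → ¬ T (r <ᵇ proj₁ y)
  ≤⇒¬descent r y le t = <⇒≱ (<ᵇ⇒< r (proj₁ y) t) le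

  cutDescents-nonEmpty : ∀ (Z : List (ℕ × A)) → NonEmptyWords (cutDescents Z)
  cutDescents-nonEmpty [] = []
  cutDescents-nonEmpty (x ∷ []) = ∷≢[] ∷ []
  cutDescents-nonEmpty ((r , c) ∷ y ∷ Z) with r <ᵇ proj₁ y | cutDescents-nonEmpty (y ∷ Z)
  ... | true  | ne = ∷≢[] ∷ ne
  ... | false | ne = addFront-nonEmpty (cutDescents (y ∷ Z)) ne
    where
    addFront-nonEmpty : ∀ W → NonEmptyWords W → NonEmptyWords (addFront c W)
    addFront-nonEmpty [] _ = ∷≢[] ∷ []
    addFront-nonEmpty (w ∷ W) (_ ∷ ne) = ∷≢[] ∷ ne

  prependHead : Word A → List (Word A) → List (Word A)
  prependHead u [] = u ∷ []
  prependHead u (d ∷ ds) = (u ++ d) ∷ ds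

  cutDescents-noDescent : ∀ (X : List (ℕ × A)) → X ≢ [] → NoDescent X → cutDescents X ≡ map proj₂ X ∷ []
  cutDescents-noDescent [] X≢[] _ = ⊥-elim (X≢[] refl)
  cutDescents-noDescent (x ∷ []) _ _ = refl
  cutDescents-noDescent ((r , c) ∷ y ∷ X) _ (le ∷ nd) =
    trans (cutDescents-ascent r c y X (≤⇒¬descent r y le)) (cong (addFront c) (cutDescents-noDescent (y ∷ X) (λ ()) nd))

  cutDescents-++ : ∀ (X R : List (ℕ × A)) → X ≢ [] → NoDescent X → R ≢ [] →
    cutDescents (X ++ R) ≡ map proj₂ X ∷ cutDescents R ⊎ cutDescents (X ++ R) ≡ prependHead (map proj₂ X) (cutDescents R)
  cutDescents-++ [] R X≢[] _ _ = ⊥-elim (X≢[] refl)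
  cutDescents-++ ((r , c) ∷ []) [] _ _ R≢[] = ⊥-elim (R≢[] refl)
  cutDescents-++ ((r , c) ∷ []) (y ∷ R) _ _ _ with r <ᵇ proj₁ y
  ... | true = inj₁ refl
  ... | false = inj₂ (addFront≡prependHead (cutDescents (y ∷ R)) (cutDescents-∷≢[] y R))
    where
    addFront≡prependHead : ∀ W → W ≢ [] → addFront c W ≡ prependHead (c ∷ []) W
    addFront≡prependHead [] W≢[] = ⊥-elim (W≢[] refl)
    addFront≡prependHead (d ∷ ds) _ = refl
  cutDescents-++ ((r , c) ∷ y ∷ X) R _ (le ∷ nd) R≢[] with cutDescents-++ (y ∷ X) R (λ ()) nd R≢[]
  ... | inj₁ e = inj₁ (trans (cutDescents-ascent r c y (X ++ R) (≤⇒¬descent r y le)) (cong (addFront c) e))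
  ... | inj₂ e = inj₂ (trans (cutDescents-ascent r c y (X ++ R) (≤⇒¬descent r y le))
                             (trans (cong (addFront c) e) (addFront-prependHead (cutDescents R))))
    where
    addFront-prependHead : ∀ W → addFront c (prependHead (map proj₂ (y ∷ X)) W) ≡ prependHead (map proj₂ ((r , c) ∷ y ∷ X)) W
    addFront-prependHead [] = refl
    addFront-prependHead (d ∷ ds) = refl

  Blocks : Sentence A → List (ℕ × A) → List (List (ℕ × A)) → Set
  Blocks B Z Zs = concat Zs ≡ Z × map (map proj₂) Zs ≡ words B × All NoDescent Zs

  colors≡toList⇒≢[] : ∀ (b : List⁺ A) (Z : List (ℕ × A)) → map proj₂ Z ≡ toList b → Z ≢ []
  colors≡toList⇒≢[] b Z e refl = toList≢[] b (sym e)

  cutDescents-∈-coarseningWords : ∀ (B : Sentence A) (Zs : List (List (ℕ × A))) →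
    map (map proj₂) Zs ≡ words B → All NoDescent Zs → cutDescents (concat Zs) ∈ coarseningWords B
  cutDescents-∈-coarseningWords [] [] _ _ = here refl
  cutDescents-∈-coarseningWords (b ∷ []) (Z₁ ∷ []) e (nd ∷ []) =
    let e₁ = ∷-injectiveˡ e in
    here (trans (cong cutDescents (++-identityʳ Z₁))
      (trans (cutDescents-noDescent Z₁ (colors≡toList⇒≢[] b Z₁ e₁) nd) (cong (_∷ []) e₁)))
  cutDescents-∈-coarseningWords (b ∷ v ∷ ws) (Z₁ ∷ Z₂ ∷ Zs) e (nd₁ ∷ nds) =
    subst (cutDescents (Z₁ ++ R) ∈_) (sym (coarseningWords-∷∷ b v ws))
      (extend (cutDescents R) ih (coarseningWords-≢[] v ws ih)
        (cutDescents-++ Z₁ R (colors≡toList⇒≢[] b Z₁ e₁) nd₁ R≢[]))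
    where
    R = concat (Z₂ ∷ Zs)
    e₁ = ∷-injectiveˡ e
    concat≢[] : ∀ Y → Y ≢ [] → concat (Y ∷ Zs) ≢ []
    concat≢[] [] Y≢[] _ = Y≢[] refl
    concat≢[] (_ ∷ _) _ ()
    R≢[] : R ≢ []
    R≢[] = concat≢[] Z₂ (colors≡toList⇒≢[] v Z₂ (∷-injectiveˡ (∷-injectiveʳ e)))
    ih : cutDescents R ∈ coarseningWords (v ∷ ws)
    ih = cutDescents-∈-coarseningWords (v ∷ ws) (Z₂ ∷ Zs) (∷-injectiveʳ e) nds
    extend : ∀ D → D ∈ coarseningWords (v ∷ ws) → D ≢ [] →
      (cutDescents (Z₁ ++ R) ≡ map proj₂ Z₁ ∷ D ⊎ cutDescents (Z₁ ++ R) ≡ prependHead (map proj₂ Z₁) D) →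
      cutDescents (Z₁ ++ R) ∈ concatMap (prefixings (toList b)) (coarseningWords (v ∷ ws))
    extend D m _ (inj₁ eq) = subst (_∈ _) (sym (trans eq (cong (_∷ D) e₁)))
      (∈-concat⁺′ (here refl) (∈-map⁺ (prefixings (toList b)) m))
    extend [] m D≢[] (inj₂ eq) = ⊥-elim (D≢[] refl)
    extend (d ∷ ds) m _ (inj₂ eq) = subst (_∈ _) (sym (trans eq (cong (λ u → (u ++ d) ∷ ds) e₁)))
      (∈-concat⁺′ (there (here refl)) (∈-map⁺ (prefixings (toList b)) m))

  consNonEmpty : Word A → List (Word A) → List (Word A)
  consNonEmpty [] W = W
  consNonEmpty (x ∷ xs) W = (x ∷ xs) ∷ W

  consNonEmpty-≢[] : ∀ d ds → d ≢ [] → consNonEmpty d ds ≡ d ∷ ds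
  consNonEmpty-≢[] [] ds d≢[] = ⊥-elim (d≢[] refl)
  consNonEmpty-≢[] (_ ∷ _) ds _ = refl

  ++≡[c] : ∀ (c : A) u u' → u ≢ [] → u ++ u' ≡ c ∷ [] → u ≡ c ∷ [] × u' ≡ []
  ++≡[c] c [] u' u≢[] e = ⊥-elim (u≢[] refl)
  ++≡[c] c (x ∷ []) [] _ refl = refl , refl
  ++≡[c] c (x ∷ []) (_ ∷ _) _ ()
  ++≡[c] c (x ∷ _ ∷ _) u' _ ()

  -- The rest R continues with the remainder u' of the current word, or directly with W when u' is empty.
  SplitsAs : List (ℕ × A) → Word A → Word A → List (Word A) → Set
  SplitsAs Z u u' W = ∃ λ X → ∃ λ R → Z ≡ X ++ R × map proj₂ X ≡ u × NoDescent X × cutDescents R ≡ consNonEmpty u' W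

  cutDescents-split-ascent : ∀ r (c : A) y (Z : List (ℕ × A)) u u' W → u ≢ [] → ¬ T (r <ᵇ proj₁ y) →
     ∀ V → cutDescents (y ∷ Z) ≡ V → NonEmptyWords V → V ≢ [] → addFront c V ≡ (u ++ u') ∷ W →
     (∀ u₀ W' → u₀ ≢ [] → cutDescents (y ∷ Z) ≡ (u₀ ++ u') ∷ W' → SplitsAs (y ∷ Z) u₀ u' W') →
     SplitsAs ((r , c) ∷ y ∷ Z) u u' W
  cutDescents-split-ascent r c y Z u u' W u≢[] nd [] _ _ V≢[] _ ih = ⊥-elim (V≢[] refl)
  cutDescents-split-ascent r c y Z [] u' W u≢[] nd (w' ∷ W') eV (gw ∷ _) _ e₂ ih = ⊥-elim (u≢[] refl)
  cutDescents-split-ascent r c y Z (c' ∷ []) u' W u≢[] nd (w' ∷ W') eV (w'≢[] ∷ _) _ e₂ ih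
    with refl , refl ← ∷-injective e₂ =
    (r , c) ∷ [] , y ∷ Z , refl , refl , [-] , trans eV (sym (consNonEmpty-≢[] w' W' w'≢[]))
  cutDescents-split-ascent r c y Z (c' ∷ x ∷ u₀) u' W u≢[] nd (w' ∷ W') eV (gw ∷ _) _ e₂ ih
    with e₃ , refl ← ∷-injective e₂ with refl , e₄ ← ∷-injective e₃
    with ih (x ∷ u₀) W' ∷≢[] (trans eV (cong (_∷ W') e₄))
  ... | [] , R , e₅ , () , nd' , e₆
  ... | (y' ∷ X') , R , e₅ , e₇ , nd' , e₆ with refl , refl ← ∷-injective e₅ =
    (r , c) ∷ y ∷ X' , R , refl , cong (c ∷_) e₇ , ≮⇒≥ (λ lt → nd (<⇒<ᵇ lt)) ∷ nd' , e₆

  cutDescents-split-descent : ∀ r (c : A) y (Z : List (ℕ × A)) u u' W → u ≢ [] →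
    (c ∷ []) ∷ cutDescents (y ∷ Z) ≡ (u ++ u') ∷ W → SplitsAs ((r , c) ∷ y ∷ Z) u u' W
  cutDescents-split-descent r c y Z u u' W u≢[] e with e₁ , refl ← ∷-injective e
    with refl , refl ← ++≡[c] c u u' u≢[] (sym e₁) =
    (r , c) ∷ [] , y ∷ Z , refl , refl , [-] , refl

  cutDescents-split : ∀ (Z : List (ℕ × A)) u u' W → u ≢ [] → cutDescents Z ≡ (u ++ u') ∷ W → SplitsAs Z u u' W
  cutDescents-split [] u u' W u≢[] ()
  cutDescents-split ((r , c) ∷ []) u u' W u≢[] e with e₁ , refl ← ∷-injective e
    with refl , refl ← ++≡[c] c u u' u≢[] (sym e₁) =
    (r , c) ∷ [] , [] , refl , refl , [-] , refl
  cutDescents-split ((r , c) ∷ y ∷ Z) u u' W u≢[] e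
    with ih ← (λ u₀ → cutDescents-split (y ∷ Z) u₀ u') | r <ᵇ proj₁ y in eq
  ... | true = cutDescents-split-descent r c y Z u u' W u≢[] e
  ... | false = cutDescents-split-ascent r c y Z u u' W u≢[] (subst T eq) (cutDescents (y ∷ Z)) refl
                  (cutDescents-nonEmpty (y ∷ Z)) (cutDescents-∷≢[] y Z) e ih

  blocks-of-cutDescents-∷∷ : ∀ (b v : List⁺ A) ws (Z : List (ℕ × A)) → cutDescents Z ∈ coarseningWords (b ∷ v ∷ ws) →
    (∀ R → cutDescents R ∈ coarseningWords (v ∷ ws) → ∃ (Blocks (v ∷ ws) R)) →
    ∃ (Blocks (b ∷ v ∷ ws) Z)
  blocks-of-cutDescents-∷∷ b v ws Z m ih
    with ∈-concatMap-prefixings⁻ (toList b) (coarseningWords (v ∷ ws)) (subst (cutDescents Z ∈_) (coarseningWords-∷∷ b v ws) m)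
  ... | D' , mD' , inj₁ e
    with X , R , refl , e₁ , nd , e₂ ← cutDescents-split Z (toList b) [] D' (toList≢[] b) (trans e (cong (_∷ D') (sym (++-identityʳ (toList b)))))
    with Zs , e₃ , e₄ , nds ← ih R (subst (_∈ coarseningWords (v ∷ ws)) (sym e₂) mD') =
    X ∷ Zs , cong (X ++_) e₃ , cong₂ _∷_ e₁ e₄ , nd ∷ nds
  ... | D' , mD' , inj₂ (d , ds , refl , e)
    with X , R , refl , e₁ , nd , e₂ ← cutDescents-split Z (toList b) d ds (toList≢[] b) e
    with Zs , e₃ , e₄ , nds ← ih R (subst (_∈ coarseningWords (v ∷ ws))
           (sym (trans e₂ (consNonEmpty-≢[] d ds (All.lookup (coarseningWords-nonEmpty (v ∷ ws) mD') (here refl))))) mD') =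
    X ∷ Zs , cong (X ++_) e₃ , cong₂ _∷_ e₁ e₄ , nd ∷ nds

  blocks-of-cutDescents : ∀ (B : Sentence A) (Z : List (ℕ × A)) → cutDescents Z ∈ coarseningWords B → ∃ (Blocks B Z)
  blocks-of-cutDescents [] Z (here e) = [] , sym (cutDescents≡[]⇒≡[] Z e) , refl , []
  blocks-of-cutDescents (b ∷ []) Z (here e)
    with X , R , refl , e₁ , nd , e₂ ← cutDescents-split Z (toList b) [] [] (toList≢[] b) (trans e (cong (_∷ []) (sym (++-identityʳ (toList b)))))
    rewrite cutDescents≡[]⇒≡[] R e₂ = X ∷ [] , refl , cong (_∷ []) e₁ , nd ∷ []
  blocks-of-cutDescents (b ∷ v ∷ ws) Z m = blocks-of-cutDescents-∷∷ b v ws Z m (blocks-of-cutDescents (v ∷ ws))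

module Boxes {A : Set} where

  rowOf : ∀ {L : Set} → L × ℕ × A → ℕ
  rowOf = proj₁ ∘ proj₂

  labelOf : ∀ {L : Set} → L × ℕ × A → L
  labelOf = proj₁

  inRow : ∀ {L : Set} → ℕ → List (L × ℕ × A) → List (L × ℕ × A)
  inRow r = filterᵇ (λ b → rowOf b ≡ᵇ r)

  dropRow : ∀ {L : Set} → L × ℕ × A → L × A
  dropRow (v , r , c) = (v , c)

  dropLabel : ∀ {L : Set} → L × ℕ × A → ℕ × A
  dropLabel (v , r , c) = (r , c)

  putInRow : ∀ {L : Set} → ℕ → L × A → L × ℕ × A
  putInRow r (v , c) = (v , r , c)

  putLabel : ∀ {L : Set} → L → ℕ × A → L × ℕ × A
  putLabel v (r , c) = (v , r , c)

  mapLabel : ∀ {L L' : Set} → (L → L') → L × ℕ × A → L' × ℕ × A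
  mapLabel f (v , r , c) = (f v , r , c)

  mapLabel′ : ∀ {L L' : Set} → (L → L') → L × A → L' × A
  mapLabel′ f (v , c) = (f v , c)

  -- A box is (label, row, colour); a list of boxes describes the filling whose r-th row lists, in
  -- order, the labels and colours of its boxes in row r.
  fillingOf : ∀ {L : Set} → ℕ → List (L × ℕ × A) → List (List (L × A))
  fillingOf k Q = map (λ r → map dropRow (inRow r Q)) (vals k)

  labels : ∀ {L : Set} → List (List (L × A)) → List (List L)
  labels = map (map proj₁)

  tagRows : ∀ {L : Set} → ℕ → List (List (L × A)) → List (List (L × ℕ × A))
  tagRows s [] = []
  tagRows s (row ∷ rows) = map (putInRow s) row ∷ tagRows (suc s) rows

  withRows-∷ : ∀ s (row : List (ℕ × A)) rows → withRows s (row ∷ rows) ≡ map (putInRow s) row ++ withRows (suc s) rows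
  withRows-∷ s [] rows = refl
  withRows-∷ s (x ∷ row) rows = cong (_ ∷_) (withRows-∷ s row rows)

  withRows≡concat-tagRows : ∀ s (CF : List (List (ℕ × A))) → withRows s CF ≡ concat (tagRows s CF)
  withRows≡concat-tagRows s [] = refl
  withRows≡concat-tagRows s (row ∷ rows) = trans (withRows-∷ s row rows) (cong (map (putInRow s) row ++_) (withRows≡concat-tagRows (suc s) rows))

  concat-reverse-∷ : ∀ {X : Set} (x : List X) xs → concat (reverse (x ∷ xs)) ≡ concat (reverse xs) ++ x
  concat-reverse-∷ x xs = trans (cong concat (unfold-reverse x xs))
     (trans (sym (concat-++ (reverse xs) (x ∷ []))) (cong (concat (reverse xs) ++_) (++-identityʳ x)))

  tagRows-rows≥ : ∀ {L : Set} s (CF : List (List (L × A))) → All (λ b → s ≤ rowOf b) (concat (tagRows s CF))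
  tagRows-rows≥ s [] = []
  tagRows-rows≥ s (row ∷ rows) = AllP.++⁺ (row≥ row) (All.map (λ le → ≤-trans (n≤1+n s) le) (tagRows-rows≥ (suc s) rows))
    where row≥ : ∀ row → All (λ b → s ≤ rowOf b) (map (putInRow s) row)
          row≥ [] = []
          row≥ (_ ∷ row) = ≤-refl ∷ row≥ row

  tagRows-rows< : ∀ {L : Set} s (CF : List (List (L × A))) → All (λ b → rowOf b < s + length CF) (concat (tagRows s CF))
  tagRows-rows< s [] = []
  tagRows-rows< s (row ∷ rows) = AllP.++⁺ (row< row) (All.map (λ {b} lt → subst (rowOf b <_) (sym (+-suc s (length rows))) lt) (tagRows-rows< (suc s) rows))
    where row< : ∀ row → All (λ b → rowOf b < s + suc (length rows)) (map (putInRow s) row)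
          row< [] = []
          row< (_ ∷ row) = m<m+n s (s≤s z≤n) ∷ row< row

  inRow-none : ∀ {L : Set} r (Q : List (L × ℕ × A)) → All (λ b → ¬ rowOf b ≡ r) Q → inRow r Q ≡ []
  inRow-none r Q h = filter-none (T? ∘ _) {xs = Q} (All.map (λ {b} n t → n (≡ᵇ⇒≡ (rowOf b) r t)) h)

  inRow-putInRow : ∀ {L : Set} r (row : List (L × A)) → inRow r (map (putInRow r) row) ≡ map (putInRow r) row
  inRow-putInRow r [] = refl
  inRow-putInRow r (x ∷ row) = trans (filter-accept (T? ∘ _) {x = putInRow r x} {xs = map (putInRow r) row} (≡⇒≡ᵇ r r refl)) (cong (_ ∷_) (inRow-putInRow r row))

  inRow-putInRow-≢ : ∀ {L : Set} r s (row : List (L × A)) → ¬ s ≡ r → inRow r (map (putInRow s) row) ≡ []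
  inRow-putInRow-≢ r s [] n = refl
  inRow-putInRow-≢ r s (x ∷ row) n = trans (filter-reject (T? ∘ _) {x = putInRow s x} {xs = map (putInRow s) row} (λ t → n (≡ᵇ⇒≡ s r t))) (inRow-putInRow-≢ r s row n)

  dropRow-putInRow : ∀ {L : Set} r (row : List (L × A)) → map dropRow (map (putInRow r) row) ≡ row
  dropRow-putInRow r [] = refl
  dropRow-putInRow r (x ∷ row) = cong (x ∷_) (dropRow-putInRow r row)

  inRow-concat-reverse : ∀ {L : Set} s (CF : List (List (L × A))) r →
     inRow r (concat (tagRows s CF)) ≡ inRow r (concat (reverse (tagRows s CF)))
  inRow-concat-reverse s [] r = refl
  inRow-concat-reverse s (row ∷ rows) r with s ℕ.≟ r
  ... | yes refl =
     begin
       inRow s (map (putInRow s) row ++ concat (tagRows (suc s) rows))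
     ≡⟨ filter-++ (T? ∘ _) (map (putInRow s) row) _ ⟩
       inRow s (map (putInRow s) row) ++ inRow s (concat (tagRows (suc s) rows))
     ≡⟨ cong (inRow s (map (putInRow s) row) ++_) none1 ⟩
       inRow s (map (putInRow s) row) ++ []
     ≡⟨ ++-identityʳ _ ⟩
       inRow s (map (putInRow s) row)
     ≡⟨ cong (_++ inRow s (map (putInRow s) row)) (sym (trans (sym (inRow-concat-reverse (suc s) rows s)) none1)) ⟩
       inRow s (concat (reverse (tagRows (suc s) rows))) ++ inRow s (map (putInRow s) row)
     ≡⟨ sym (filter-++ (T? ∘ _) (concat (reverse (tagRows (suc s) rows))) _) ⟩
       inRow s (concat (reverse (tagRows (suc s) rows)) ++ map (putInRow s) row)
     ≡⟨ cong (inRow s) (sym (concat-reverse-∷ (map (putInRow s) row) (tagRows (suc s) rows))) ⟩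
       inRow s (concat (reverse (tagRows s (row ∷ rows))))
     ∎
    where
    open ≡-Reasoning
    none1 : inRow s (concat (tagRows (suc s) rows)) ≡ []
    none1 = inRow-none s _ (All.map (λ le e → <-irrefl (sym e) le) (tagRows-rows≥ (suc s) rows))
  ... | no n =
     begin
       inRow r (map (putInRow s) row ++ concat (tagRows (suc s) rows))
     ≡⟨ filter-++ (T? ∘ _) (map (putInRow s) row) _ ⟩
       inRow r (map (putInRow s) row) ++ inRow r (concat (tagRows (suc s) rows))
     ≡⟨ cong (_++ inRow r (concat (tagRows (suc s) rows))) (inRow-putInRow-≢ r s row n) ⟩
       inRow r (concat (tagRows (suc s) rows))
     ≡⟨ inRow-concat-reverse (suc s) rows r ⟩
       inRow r (concat (reverse (tagRows (suc s) rows)))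
     ≡⟨ sym (++-identityʳ _) ⟩
       inRow r (concat (reverse (tagRows (suc s) rows))) ++ []
     ≡⟨ cong (inRow r (concat (reverse (tagRows (suc s) rows))) ++_) (sym (inRow-putInRow-≢ r s row n)) ⟩
       inRow r (concat (reverse (tagRows (suc s) rows))) ++ inRow r (map (putInRow s) row)
     ≡⟨ sym (filter-++ (T? ∘ _) (concat (reverse (tagRows (suc s) rows))) _) ⟩
       inRow r (concat (reverse (tagRows (suc s) rows)) ++ map (putInRow s) row)
     ≡⟨ cong (inRow r) (sym (concat-reverse-∷ (map (putInRow s) row) (tagRows (suc s) rows))) ⟩
       inRow r (concat (reverse (tagRows s (row ∷ rows))))
     ∎
    where open ≡-Reasoning

  fillingOf-tagRows : ∀ {L : Set} s (CF : List (List (L × A))) → map (λ r → map dropRow (inRow r (concat (tagRows s CF)))) (range s (length CF)) ≡ CF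
  fillingOf-tagRows s [] = refl
  fillingOf-tagRows s (row ∷ rows) = cong₂ _∷_ hd tl
    where
    none1 : inRow s (concat (tagRows (suc s) rows)) ≡ []
    none1 = inRow-none s _ (All.map (λ le e → <-irrefl (sym e) le) (tagRows-rows≥ (suc s) rows))
    hd : map dropRow (inRow s (map (putInRow s) row ++ concat (tagRows (suc s) rows))) ≡ row
    hd = trans (cong (map dropRow) (trans (filter-++ (T? ∘ _) (map (putInRow s) row) _) (cong₂ _++_ (inRow-putInRow s row) none1)))
         (trans (cong (map dropRow) (++-identityʳ _)) (dropRow-putInRow s row))
    tl : map (λ r → map dropRow (inRow r (map (putInRow s) row ++ concat (tagRows (suc s) rows)))) (range (suc s) (length rows)) ≡ rows
    tl = trans (map-cong-local (All.tabulate (λ {r} m →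
            cong (map dropRow) (trans (filter-++ (T? ∘ _) (map (putInRow s) row) _)
              (cong (_++ inRow r (concat (tagRows (suc s) rows))) (inRow-putInRow-≢ r s row
                 (λ e → <-irrefl e (proj₁ (∈-range⁻ (suc s) (length rows) m)))))))))
          (fillingOf-tagRows (suc s) rows)

  fillingOf-withRows : ∀ (CF : List (List (ℕ × A))) → fillingOf (length CF) (withRows 1 CF) ≡ CF
  fillingOf-withRows CF = trans (cong₂ (λ a b → map (λ r → map dropRow (inRow r a)) b) (withRows≡concat-tagRows 1 CF) (vals≡range (length CF))) (fillingOf-tagRows 1 CF)

  inRow-rowOf : ∀ {L : Set} r (Q : List (L × ℕ × A)) → All (λ b → rowOf b ≡ r) (inRow r Q)
  inRow-rowOf r Q = All.tabulate (λ {b} m → ≡ᵇ⇒≡ (rowOf b) r (proj₂ (∈-filter⁻ (T? ∘ _) {xs = Q} m)))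

  putInRow-dropRow : ∀ {L : Set} r (X : List (L × ℕ × A)) → All (λ b → rowOf b ≡ r) X → map (putInRow r) (map dropRow X) ≡ X
  putInRow-dropRow r [] [] = refl
  putInRow-dropRow r (x ∷ X) (refl ∷ h) = cong (x ∷_) (putInRow-dropRow r X h)

  tagRows-fillingOf : ∀ {L : Set} s m (Q : List (L × ℕ × A)) → tagRows s (map (λ r → map dropRow (inRow r Q)) (range s m)) ≡ map (λ r → inRow r Q) (range s m)
  tagRows-fillingOf s zero Q = refl
  tagRows-fillingOf s (suc m) Q = cong₂ _∷_ (putInRow-dropRow s (inRow s Q) (inRow-rowOf s Q)) (tagRows-fillingOf (suc s) m Q)

  withRows-fillingOf : ∀ (k : ℕ) (Q : List (ℕ × ℕ × A)) → withRows 1 (fillingOf k Q) ≡ concat (map (λ r → inRow r Q) (vals k))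
  withRows-fillingOf k Q = trans (withRows≡concat-tagRows 1 (fillingOf k Q))
    (trans (cong (λ l → concat (tagRows 1 (map (λ r → map dropRow (inRow r Q)) l))) (vals≡range k))
    (trans (cong concat (tagRows-fillingOf 1 k Q)) (cong (λ l → concat (map (λ r → inRow r Q) l)) (sym (vals≡range k)))))

  inRow-mapLabel : ∀ {L L' : Set} (f : L → L') r Q → inRow r (map (mapLabel f) Q) ≡ map (mapLabel f) (inRow r Q)
  inRow-mapLabel f r Q = filterᵇ-map _ (mapLabel f) Q

  fillingOf-mapLabel : ∀ {L L' : Set} (f : L → L') k Q → fillingOf k (map (mapLabel f) Q) ≡ map (map (mapLabel′ f)) (fillingOf k Q)
  fillingOf-mapLabel f k Q = trans (map-cong-local (All.tabulate (λ {r} _ → trans (cong (map dropRow) (inRow-mapLabel f r Q))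
      (trans (sym (map-∘ (inRow r Q))) (map-∘ (inRow r Q)))))) (map-∘ (vals k))

  labels-mapLabel : ∀ {L L' : Set} (f : L → L') (CF : List (List (L × A))) → labels (map (map (mapLabel′ f)) CF) ≡ map (map f) (labels CF)
  labels-mapLabel f [] = refl
  labels-mapLabel f (row ∷ CF) = cong₂ _∷_ (trans (sym (map-∘ row)) (map-∘ row)) (labels-mapLabel f CF)

  rowColours : ℕ → List (ℕ × A) → List (List A)
  rowColours k Z = map (λ r → map proj₂ (filterᵇ (λ z → proj₁ z ≡ᵇ r) Z)) (vals k)

  colours-fillingOf : ∀ {L : Set} k (Q : List (L × ℕ × A)) → map (map proj₂) (fillingOf k Q) ≡ rowColours k (map dropLabel Q)
  colours-fillingOf k Q = trans (sym (map-∘ (vals k))) (map-cong-local (All.tabulate (λ {r} _ →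
     trans (sym (map-∘ (inRow r Q))) (trans (map-∘ (inRow r Q)) (cong (map proj₂) (sym (filterᵇ-map _ dropLabel Q)))))))

  zip-unzip′ : ∀ {L : Set} (row : List (L × A)) → zip (map proj₁ row) (map proj₂ row) ≡ row
  zip-unzip′ [] = refl
  zip-unzip′ (x ∷ row) = cong (x ∷_) (zip-unzip′ row)

  colored-labels : ∀ (J : Sentence A) (CF : List (List (ℕ × A))) → map (map proj₂) CF ≡ words J → colored J (labels CF) ≡ CF
  colored-labels [] [] e = refl
  colored-labels (w ∷ J) (row ∷ CF) e with ∷-injective e
  ... | e1 , e2 = cong₂ _∷_ (trans (cong (zip (map proj₁ row)) (sym e1)) (zip-unzip′ row)) (colored-labels J CF e2)

  map-proj₁-zip : ∀ {X Y : Set} (r : List X) (w : List Y) → length r ≡ length w → map proj₁ (zip r w) ≡ r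
  map-proj₁-zip [] [] _ = refl
  map-proj₁-zip (x ∷ r) (y ∷ w) e = cong (x ∷_) (map-proj₁-zip r w (suc-injective e))
  map-proj₂-zip : ∀ {X Y : Set} (r : List X) (w : List Y) → length r ≡ length w → map proj₂ (zip r w) ≡ w
  map-proj₂-zip [] [] _ = refl
  map-proj₂-zip (x ∷ r) (y ∷ w) e = cong (y ∷_) (map-proj₂-zip r w (suc-injective e))

  length-toList : ∀ (w : List⁺ A) → List⁺.length w ≡ length (toList w)
  length-toList (_ ∷ _) = refl

  shape≡map-length-words : ∀ (J : Sentence A) → shape J ≡ map length (words J)
  shape≡map-length-words [] = refl
  shape≡map-length-words ((x ∷ xs) ∷ J) = cong (_ ∷_) (shape≡map-length-words J)

  colours-colored : ∀ (J : Sentence A) T → map length T ≡ shape J → map (map proj₂) (colored J T) ≡ words J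
  colours-colored [] [] _ = refl
  colours-colored [] (_ ∷ _) ()
  colours-colored (w ∷ J) [] ()
  colours-colored (w ∷ J) (r ∷ T) e = cong₂ _∷_ (map-proj₂-zip r (toList w) (trans (∷-injectiveˡ e) (length-toList w))) (colours-colored J T (∷-injectiveʳ e))

  labels-colored : ∀ (J : Sentence A) T → map length T ≡ shape J → labels (colored J T) ≡ T
  labels-colored [] [] _ = refl
  labels-colored [] (_ ∷ _) ()
  labels-colored (w ∷ J) [] ()
  labels-colored (w ∷ J) (r ∷ T) e = cong₂ _∷_ (map-proj₁-zip r (toList w) (trans (∷-injectiveˡ e) (length-toList w))) (labels-colored J T (∷-injectiveʳ e))

  shape-labels : ∀ (J : Sentence A) {L : Set} (CF : List (List (L × A))) → map (map proj₂) CF ≡ words J → map length (labels CF) ≡ shape J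
  shape-labels J CF e = trans (length-labels CF) (trans (cong (map length) e) (sym (shape≡map-length-words J)))
    where length-labels : ∀ {L : Set} (CF : List (List (L × A))) → map length (labels CF) ≡ map length (map (map proj₂) CF)
          length-labels [] = refl
          length-labels (row ∷ CF) = cong₂ _∷_ (trans (length-map proj₁ row) (sym (length-map proj₂ row))) (length-labels CF)

  length-words : ∀ (J : Sentence A) → length (words J) ≡ length J
  length-words J = length-map _ J

  concat-map-filterᵇ : ∀ {X Y : Set} (g : X → Y) (p : X → Bool) xss → concat (map (λ row → map g (filterᵇ p row)) xss) ≡ map g (filterᵇ p (concat xss))
  concat-map-filterᵇ g p [] = refl
  concat-map-filterᵇ g p (xs ∷ xss) = trans (cong (map g (filterᵇ p xs) ++_) (concat-map-filterᵇ g p xss))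
     (trans (sym (map-++ g (filterᵇ p xs) _)) (cong (map g) (sym (filter-++ (T? ∘ p) xs (concat xss)))))

  typeWord≡ : ∀ (J : Sentence A) T i → typeWord J T i ≡ map proj₂ (filterᵇ (λ p → proj₁ p ≡ᵇ i) (concat (reverse (colored J T))))
  typeWord≡ J T i = concat-map-filterᵇ proj₂ _ (reverse (colored J T))

  findEntry≡ : ∀ v (L : List (ℕ × ℕ × A)) → findEntry v L ≡ Maybe.map dropLabel (head (filterᵇ (λ b → labelOf b ≡ᵇ v) L))
  findEntry≡ v [] = refl
  findEntry≡ v ((e , r , c) ∷ bs) with e ≡ᵇ v
  ... | true = refl
  ... | false = findEntry≡ v bs

Linked⇒weakInc : ∀ xs → Linked _≤_ xs → T (weakInc xs)
Linked⇒weakInc [] _ = tt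
Linked⇒weakInc (x ∷ []) _ = tt
Linked⇒weakInc (x ∷ y ∷ xs) (le ∷ l) = T-∧⁺ (≤⇒≤ᵇ le) (Linked⇒weakInc (y ∷ xs) l)

weakInc⇒Linked : ∀ xs → T (weakInc xs) → Linked _≤_ xs
weakInc⇒Linked [] _ = []
weakInc⇒Linked (x ∷ []) _ = [-]
weakInc⇒Linked (x ∷ y ∷ xs) t = ≤ᵇ⇒≤ x y (T-∧ˡ t) ∷ weakInc⇒Linked (y ∷ xs) (T-∧ʳ {x ≤ᵇ y} t)

Linked⇒strictInc : ∀ xs → Linked _<_ xs → T (strictInc xs)
Linked⇒strictInc [] _ = tt
Linked⇒strictInc (x ∷ []) _ = tt
Linked⇒strictInc (x ∷ y ∷ xs) (le ∷ l) = T-∧⁺ (<⇒<ᵇ le) (Linked⇒strictInc (y ∷ xs) l)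

strictInc⇒Linked : ∀ xs → T (strictInc xs) → Linked _<_ xs
strictInc⇒Linked [] _ = []
strictInc⇒Linked (x ∷ []) _ = [-]
strictInc⇒Linked (x ∷ y ∷ xs) t = <ᵇ⇒< x y (T-∧ˡ t) ∷ strictInc⇒Linked (y ∷ xs) (T-∧ʳ {x <ᵇ y} t)

All⇒allᵇ : ∀ {X : Set} (p : X → Bool) xs → All (T ∘ p) xs → T (allᵇ p xs)
All⇒allᵇ p [] [] = tt
All⇒allᵇ p (x ∷ xs) (t ∷ ts) with p x
... | true = All⇒allᵇ p xs ts

allᵇ⇒All : ∀ {X : Set} (p : X → Bool) xs → T (allᵇ p xs) → All (T ∘ p) xs
allᵇ⇒All p [] _ = []
allᵇ⇒All p (x ∷ xs) t with p x in e
... | true = subst T (sym e) tt ∷ allᵇ⇒All p xs t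

length-concat : ∀ {X : Set} (xss : List (List X)) → length (concat xss) ≡ sum (map length xss)
length-concat [] = refl
length-concat (xs ∷ xss) = trans (length-++ xs) (cong (length xs +_) (length-concat xss))

module Build {A : Set} where
  open Boxes {A}

  numberFrom : ℕ → List (ℕ × A) → List (ℕ × ℕ × A)
  numberFrom s [] = []
  numberFrom s (z ∷ Z) = putLabel s z ∷ numberFrom (suc s) Z

  labelByBlock : ℕ → List (List (ℕ × A)) → List (ℕ × ℕ × A)
  labelByBlock i [] = []
  labelByBlock i (Zi ∷ Zs) = map (putLabel i) Zi ++ labelByBlock (suc i) Zs

  numberInBlock : ℕ → ℕ → List (ℕ × A) → List ((ℕ × ℕ) × ℕ × A)
  numberInBlock s i [] = []
  numberInBlock s i (z ∷ Z) = putLabel (s , i) z ∷ numberInBlock (suc s) i Z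

  doubleLabel : ℕ → ℕ → List (List (ℕ × A)) → List ((ℕ × ℕ) × ℕ × A)
  doubleLabel s i [] = []
  doubleLabel s i (Zi ∷ Zs) = numberInBlock s i Zi ++ doubleLabel (s + length Zi) (suc i) Zs

  numberFrom-++ : ∀ s Z Z' → numberFrom s (Z ++ Z') ≡ numberFrom s Z ++ numberFrom (s + length Z) Z'
  numberFrom-++ s [] Z' = cong (λ t → numberFrom t Z') (sym (+-identityʳ s))
  numberFrom-++ s (z ∷ Z) Z' = cong (putLabel s z ∷_) (trans (numberFrom-++ (suc s) Z Z') (cong (λ t → numberFrom (suc s) Z ++ numberFrom t Z') (sym (+-suc s (length Z)))))

  numberInBlock-position : ∀ s i Z → map (mapLabel proj₁) (numberInBlock s i Z) ≡ numberFrom s Z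
  numberInBlock-position s i [] = refl
  numberInBlock-position s i (z ∷ Z) = cong (_ ∷_) (numberInBlock-position (suc s) i Z)

  numberInBlock-block : ∀ s i Z → map (mapLabel proj₂) (numberInBlock s i Z) ≡ map (putLabel i) Z
  numberInBlock-block s i [] = refl
  numberInBlock-block s i (z ∷ Z) = cong (_ ∷_) (numberInBlock-block (suc s) i Z)

  dropLabel-numberInBlock : ∀ s i Z → map dropLabel (numberInBlock s i Z) ≡ Z
  dropLabel-numberInBlock s i [] = refl
  dropLabel-numberInBlock s i (z ∷ Z) = cong (z ∷_) (dropLabel-numberInBlock (suc s) i Z)

  doubleLabel-position : ∀ s i Zs → map (mapLabel proj₁) (doubleLabel s i Zs) ≡ numberFrom s (concat Zs)
  doubleLabel-position s i [] = refl
  doubleLabel-position s i (Zi ∷ Zs) = trans (map-++ _ (numberInBlock s i Zi) _) (trans (cong₂ _++_ (numberInBlock-position s i Zi) (doubleLabel-position (s + length Zi) (suc i) Zs))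
     (sym (numberFrom-++ s Zi (concat Zs))))

  doubleLabel-block : ∀ s i Zs → map (mapLabel proj₂) (doubleLabel s i Zs) ≡ labelByBlock i Zs
  doubleLabel-block s i [] = refl
  doubleLabel-block s i (Zi ∷ Zs) = trans (map-++ _ (numberInBlock s i Zi) _) (cong₂ _++_ (numberInBlock-block s i Zi) (doubleLabel-block (s + length Zi) (suc i) Zs))

  dropLabel-numberFrom : ∀ s Z → map dropLabel (numberFrom s Z) ≡ Z
  dropLabel-numberFrom s [] = refl
  dropLabel-numberFrom s (z ∷ Z) = cong (z ∷_) (dropLabel-numberFrom (suc s) Z)

  labels-numberFrom : ∀ s Z → map labelOf (numberFrom s Z) ≡ range s (length Z)
  labels-numberFrom s [] = refl
  labels-numberFrom s (z ∷ Z) = cong (s ∷_) (labels-numberFrom (suc s) Z)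

  numberFrom-≥ : ∀ s Z → All (λ b → s ≤ labelOf b) (numberFrom s Z)
  numberFrom-≥ s [] = []
  numberFrom-≥ s (z ∷ Z) = ≤-refl ∷ All.map (λ le → ≤-trans (n≤1+n s) le) (numberFrom-≥ (suc s) Z)

  numberFrom-increasing : ∀ s Z → AllPairs (λ x y → labelOf x < labelOf y) (numberFrom s Z)
  numberFrom-increasing s [] = []
  numberFrom-increasing s (z ∷ Z) = All.map (λ le → le) (numberFrom-≥ (suc s) Z) ∷ numberFrom-increasing (suc s) Z

  numberFrom-single : ∀ s Z {b} → b ∈ numberFrom s Z → filterᵇ (λ x → labelOf x ≡ᵇ labelOf b) (numberFrom s Z) ≡ b ∷ []
  numberFrom-single s (z ∷ Z) (here refl) = trans (filter-accept (T? ∘ _) {x = putLabel s z} {xs = numberFrom (suc s) Z} (≡⇒≡ᵇ s s refl))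
     (cong (_ ∷_) (filter-none (T? ∘ _) {xs = numberFrom (suc s) Z} (All.map (λ {x} le t → <-irrefl (sym (≡ᵇ⇒≡ (labelOf x) s t)) le) (numberFrom-≥ (suc s) Z))))
  numberFrom-single s (z ∷ Z) {b} (there m) = trans (filter-reject (T? ∘ _) {x = putLabel s z} {xs = numberFrom (suc s) Z} (λ t → <-irrefl (≡ᵇ⇒≡ s (labelOf b) t) (All.lookup (numberFrom-≥ (suc s) Z) m)))
     (numberFrom-single (suc s) Z m)

  labels-fillingOf : ∀ {L : Set} k (Q : List (L × ℕ × A)) → labels (fillingOf k Q) ≡ map (λ r → map labelOf (inRow r Q)) (vals k)
  labels-fillingOf k Q = trans (sym (map-∘ (vals k))) (map-cong-local (All.tabulate (λ {r} _ → sym (map-∘ (inRow r Q)))))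

  concat-labels-fillingOf : ∀ {L : Set} k (Q : List (L × ℕ × A)) → concat (labels (fillingOf k Q)) ≡ map labelOf (concat (map (λ r → inRow r Q) (vals k)))
  concat-labels-fillingOf k Q = trans (cong concat (trans (labels-fillingOf k Q) (map-∘ (vals k))))
     (trans (concat-map (map (λ r → inRow r Q) (vals k))) refl)

  All-labels-fillingOf : ∀ {L : Set} (P : L → Set) k (Q : List (L × ℕ × A)) → All P (map labelOf Q) → All (All P) (labels (fillingOf k Q))
  All-labels-fillingOf P k Q h = subst (All (All P)) (sym (labels-fillingOf k Q))
     (AllP.map⁺ (All.tabulate {xs = vals k} (λ {r} _ → AllP.map⁺ (AllP.filter⁺ (T? ∘ (λ b → rowOf b ≡ᵇ r)) (AllP.map⁻ h)))))

  fillingOf-rows-weakInc : ∀ k (Q : List (ℕ × ℕ × A)) → AllPairs (λ x y → labelOf x ≤ labelOf y) Q →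
     All (T ∘ weakInc) (labels (fillingOf k Q))
  fillingOf-rows-weakInc k Q sorted = subst (All (T ∘ weakInc)) (sym (labels-fillingOf k Q))
     (AllP.map⁺ (All.tabulate (λ {r} _ → Linked⇒weakInc _
       (LP.AllPairs⇒Linked (APP.map⁺ {f = labelOf} (APP.filter⁺ (T? ∘ (λ b → rowOf b ≡ᵇ r)) sorted))))))

  countOcc-range : ∀ s N i → s ≤ i → i < s + N → countOcc i (range s N) ≡ 1
  countOcc-range s zero i le lt = ⊥-elim (<-irrefl refl (≤-trans lt (subst (_≤ i) (sym (+-identityʳ s)) le)))
  countOcc-range s (suc N) i le lt with m≤n⇒m<n∨m≡n le
  ... | inj₂ refl = trans (cong length (filter-accept (T? ∘ _) {x = s} {xs = range (suc s) N} (≡⇒≡ᵇ s s refl))) (cong suc (cong length (filter-none (T? ∘ _) {xs = range (suc s) N} (All.tabulate (λ {x} m t → <-irrefl (sym (≡ᵇ⇒≡ x s t)) (proj₁ (∈-range⁻ (suc s) N m)))))))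
  ... | inj₁ s<i = trans (cong length (filter-reject (T? ∘ _) {x = s} {xs = range (suc s) N} (λ t → <-irrefl (≡ᵇ⇒≡ s i t) s<i)))
          (countOcc-range (suc s) N i s<i (subst (i <_) (+-suc s N) lt))

module Standardisation {A : Set} (_≟A_ : DecidableEquality A) (J B : Sentence A) where
  open Boxes {A}
  open Build {A}

  k = length J
  n = size J
  m = length B

  selZ : ℕ → List (ℕ × A) → List (ℕ × A)
  selZ r = filterᵇ (λ z → proj₁ z ≡ᵇ r)

  standardFilling : List (List (ℕ × A)) → Filling
  standardFilling Zs = labels (fillingOf k (numberFrom 1 (concat Zs)))

  blockFilling : List (List (ℕ × A)) → Filling
  blockFilling Zs = labels (fillingOf k (labelByBlock 1 Zs))

  -- Runs of boxes (row, colour): the i-th run holds the boxes that carry i in the block filling and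
  -- the consecutive entries of the i-th run in the standard filling.
  record Admissible (Zs : List (List (ℕ × A))) : Set where
    field
      colours≡B : map (map proj₂) Zs ≡ words B
      descentFree : All NoDescent Zs
      rows∈vals : All (λ z → proj₁ z ∈ vals k) (concat Zs)
      rowColours≡J : rowColours k (concat Zs) ≡ words J
      firstColumn-increasing : T (strictInc (firstColumn (standardFilling Zs)))

  same : List (List A) → List (List A) → Bool
  same = sameWords _≟A_

  same-sound : ∀ x y → T (same x y) → x ≡ y
  same-sound x y t = toWitness t

  same-refl : ∀ x → T (same x x)
  same-refl x = fromWitness refl

  isStandardOfCoarsening : Filling → Bool
  isStandardOfCoarsening U = isImmaculate U ∧ (isStandard J U ∧ anyᵇ (λ C → same (descentComposition J U) (words C)) (coarsenings B))

  isTableauOfType : Filling → Bool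
  isTableauOfType T' = isImmaculate T' ∧ same (typeOf J T') (words B)

  length-reading : ∀ (Z : List (ℕ × A)) → All (λ z → proj₁ z ∈ vals k) Z → rowColours k Z ≡ words J → length Z ≡ n
  length-reading Z rows∈vals rowColours≡J = sym (begin
      sum (shape J)
    ≡⟨ cong sum (shape≡map-length-words J) ⟩
      sum (map length (words J))
    ≡⟨ cong (sum ∘ map length) (sym rowColours≡J) ⟩
      sum (map length (rowColours k Z))
    ≡⟨ cong sum (trans (sym (map-∘ (vals k))) (trans (map-cong-local (All.tabulate (λ {r} _ → length-map proj₂ (selZ r Z)))) (map-∘ (vals k)))) ⟩
      sum (map length (map (λ r → selZ r Z) (vals k)))
    ≡⟨ sym (length-concat (map (λ r → selZ r Z) (vals k))) ⟩
      length (concat (map (λ r → selZ r Z) (vals k)))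
    ≡⟨ ↭-length (Fibres.fibres-↭ proj₁ Z (vals k) rows∈vals (vals-unique k)) ⟩
      length Z
    ∎)
    where open ≡-Reasoning

  mapMaybe-∷-just : ∀ {X Y : Set} (f : X → Maybe Y) x xs {y} → f x ≡ just y → mapMaybe f (x ∷ xs) ≡ y ∷ mapMaybe f xs
  mapMaybe-∷-just f x xs e rewrite e = refl

  rows-numberFrom : ∀ (Z : List (ℕ × A)) {P : ℕ → Set} → All (λ z → P (proj₁ z)) Z → All (λ b → P (rowOf b)) (numberFrom 1 Z)
  rows-numberFrom Z {P} h = go 1 Z h
    where go : ∀ s Z → All (λ z → P (proj₁ z)) Z → All (λ b → P (rowOf b)) (numberFrom s Z)
          go s [] [] = []
          go s (z ∷ Z) (p ∷ ps) = p ∷ go (suc s) Z ps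

  module StandardFromBlocks (Zs : List (List (ℕ × A))) (G : Admissible Zs) where
    open Admissible G
    Z = concat Zs
    Qs = numberFrom 1 Z
    CF = fillingOf k Qs
    U = standardFilling Zs

    colours-rows : map (map proj₂) CF ≡ words J
    colours-rows = trans (colours-fillingOf k Qs) (trans (cong (rowColours k) (dropLabel-numberFrom 1 Z)) rowColours≡J)

    colored≡ : colored J U ≡ CF
    colored≡ = colored-labels J CF colours-rows

    shape≡ : map length U ≡ shape J
    shape≡ = shape-labels J CF colours-rows

    length-reading′ : length Z ≡ n
    length-reading′ = length-reading Z rows∈vals rowColours≡J

    rows∈vals-numbered : All (λ b → rowOf b ∈ vals k) Qs
    rows∈vals-numbered = rows-numberFrom Z rows∈vals

    entries-bounded : All (All (InVals n)) U
    entries-bounded = All-labels-fillingOf (InVals n) k Qs (subst (All (InVals n)) (sym (labels-numberFrom 1 Z))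
       (All.tabulate (λ {x} mx → let (a , b) = ∈-range⁻ 1 (length Z) mx in a , ≤-pred (subst (x <_) (cong suc length-reading′) b))))

    enumerated : U ∈ fillingsUpTo n (shape J)
    enumerated = ∈-fillingsUpTo⁺ n (shape J) U shape≡ entries-bounded

    immaculate : T (isImmaculate U)
    immaculate = T-∧⁺ (All⇒allᵇ weakInc U (fillingOf-rows-weakInc k Qs (AllPairs.map <⇒≤ (numberFrom-increasing 1 Z)))) firstColumn-increasing

    rowFibresNumbered = concat (map (λ r → inRow r Qs) (vals k))

    fibres-↭-numbered : rowFibresNumbered ↭ Qs
    fibres-↭-numbered = Fibres.fibres-↭ rowOf Qs (vals k) rows∈vals-numbered (vals-unique k)

    withRows≡fibres : withRows 1 (colored J U) ≡ rowFibresNumbered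
    withRows≡fibres = trans (cong (withRows 1) colored≡) (withRows-fillingOf k Qs)

    count≡1 : ∀ i → i ∈ vals n → countOcc i (concat U) ≡ 1
    count≡1 i mi = begin
        length (filterᵇ (λ x → x ≡ᵇ i) (concat U))
      ≡⟨ cong (length ∘ filterᵇ (λ x → x ≡ᵇ i)) (concat-labels-fillingOf k Qs) ⟩
        length (filterᵇ (λ x → x ≡ᵇ i) (map labelOf rowFibresNumbered))
      ≡⟨ trans (cong length (filterᵇ-map _ labelOf rowFibresNumbered)) (length-map labelOf (filterᵇ (λ b → labelOf b ≡ᵇ i) rowFibresNumbered)) ⟩
        length (filterᵇ (λ b → labelOf b ≡ᵇ i) rowFibresNumbered)
      ≡⟨ length-filterᵇ-↭ _ fibres-↭-numbered ⟩
        length (filterᵇ (λ b → labelOf b ≡ᵇ i) Qs)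
      ≡⟨ sym (trans (cong length (filterᵇ-map _ labelOf Qs)) (length-map labelOf (filterᵇ (λ b → labelOf b ≡ᵇ i) Qs))) ⟩
        length (filterᵇ (λ x → x ≡ᵇ i) (map labelOf Qs))
      ≡⟨ cong (length ∘ filterᵇ (λ x → x ≡ᵇ i)) (labels-numberFrom 1 Z) ⟩
        countOcc i (range 1 (length Z))
      ≡⟨ countOcc-range 1 (length Z) i (proj₁ (∈-vals⁻ n mi)) (subst (i <_) (cong suc (sym length-reading′)) (s≤s (proj₂ (∈-vals⁻ n mi)))) ⟩
        1
      ∎
      where open ≡-Reasoning

    standard : T (isStandard J U)
    standard = All⇒allᵇ _ (vals n) (All.tabulate {xs = vals n} (λ {i} mi → ≡⇒≡ᵇ _ 1 (count≡1 i mi)))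

    findEntry-numbered : ∀ {b} → b ∈ Qs → findEntry (labelOf b) rowFibresNumbered ≡ just (dropLabel b)
    findEntry-numbered {b} mb = trans (findEntry≡ (labelOf b) rowFibresNumbered)
       (cong (Maybe.map dropLabel ∘ head) (↭-singleton-inv (↭-trans (filter-↭ (T? ∘ (λ x → labelOf x ≡ᵇ labelOf b)) fibres-↭-numbered)
          (↭-reflexive (numberFrom-single 1 Z mb)))))

    readByEntry-numbered : ∀ s Z' → (∀ {b} → b ∈ numberFrom s Z' → findEntry (labelOf b) rowFibresNumbered ≡ just (dropLabel b)) →
          mapMaybe (λ i → findEntry i rowFibresNumbered) (range s (length Z')) ≡ Z'
    readByEntry-numbered s [] h = refl
    readByEntry-numbered s (z ∷ Z') h = trans (mapMaybe-∷-just _ s (range (suc s) (length Z')) (h (here refl))) (cong (z ∷_) (readByEntry-numbered (suc s) Z' (h ∘ there)))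

    readByEntry≡ : readByEntry J U ≡ Z
    readByEntry≡ = trans (cong₂ (λ L v → mapMaybe (λ i → findEntry i L) v) withRows≡fibres (trans (vals≡range n) (cong (range 1) (sym length-reading′))))
             (readByEntry-numbered 1 Z findEntry-numbered)

    coarsens-B : T (anyᵇ (λ C → same (descentComposition J U) (words C)) (coarsenings B))
    coarsens-B with ∈-map⁻ words (cutDescents-∈-coarseningWords B Zs colours≡B descentFree)
    ... | C , mC , e = anyᵇ⁺ _ (coarsenings B) mC (subst (λ t → T (same t (words C))) (sym (trans (cong cutDescents readByEntry≡) e)) (same-refl (words C)))

    standardFromBlocks : U ∈ fillingsUpTo n (shape J) × T (isStandardOfCoarsening U) × readByEntry J U ≡ Z
    standardFromBlocks = enumerated , T-∧⁺ immaculate (T-∧⁺ standard coarsens-B) , readByEntry≡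

module FirstColumn {A : Set} where
  open Boxes {A}
  open Build {A}

  heads : ∀ {L : Set} → ℕ → List (L × ℕ × A) → List (L × ℕ × A)
  heads k Q = mapMaybe (λ r → head (inRow r Q)) (vals k)

  headM-map : ∀ {X : Set} (g : X → ℕ) (xs : List X) → headM (map g xs) ≡ Maybe.map g (head xs)
  headM-map g [] = refl
  headM-map g (x ∷ xs) = refl

  mapMaybe-ext : ∀ {X Y : Set} (p q : X → Maybe Y) xs → (∀ {x} → x ∈ xs → p x ≡ q x) → mapMaybe p xs ≡ mapMaybe q xs
  mapMaybe-ext p q xs h = cong catMaybes (map-cong-local (All.tabulate h))

  firstColumn-heads : ∀ {L : Set} (f : L → ℕ) k (Q : List (L × ℕ × A)) → firstColumn (map (map f) (labels (fillingOf k Q))) ≡ map (f ∘ labelOf) (heads k Q)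
  firstColumn-heads f k Q = trans (cong (mapMaybe headM) (trans (cong (map (map f)) (labels-fillingOf k Q)) (sym (map-∘ (vals k)))))
     (trans (mapMaybe-map headM _ (vals k))
     (trans (mapMaybe-ext _ _ (vals k) (λ {r} _ → trans (cong headM (sym (map-∘ (inRow r Q)))) (headM-map (f ∘ labelOf) (inRow r Q))))
     (sym (map-mapMaybe (f ∘ labelOf) (λ r → head (inRow r Q)) (vals k)))))

  pos blk : (ℕ × ℕ) × ℕ × A → ℕ
  pos b = proj₁ (labelOf b)
  blk b = proj₂ (labelOf b)

  -- Labels are (standard entry, block entry).  Along the reading both weakly increase, the first strictly,
  -- and inside a block rows weakly rise; so one first column increases strictly iff the other does.
  BlockOrder : (ℕ × ℕ) × ℕ × A → (ℕ × ℕ) × ℕ × A → Set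
  BlockOrder x y = pos x < pos y × blk x ≤ blk y × (blk x ≡ blk y → rowOf y ≤ rowOf x)

  AllPairs-∈-trichotomy : ∀ {X : Set} {R : X → X → Set} {xs} → AllPairs R xs → ∀ {x y} → x ∈ xs → y ∈ xs → x ≡ y ⊎ R x y ⊎ R y x
  AllPairs-∈-trichotomy (px ∷ _) (here refl) (here refl) = inj₁ refl
  AllPairs-∈-trichotomy (px ∷ _) (here refl) (there my) = inj₂ (inj₁ (All.lookup px my))
  AllPairs-∈-trichotomy (px ∷ _) (there mx) (here refl) = inj₂ (inj₂ (All.lookup px mx))
  AllPairs-∈-trichotomy (_ ∷ ps) (there mx) (there my) = AllPairs-∈-trichotomy ps mx my

  numberInBlock-bounds : ∀ s i Z → All (λ b → s ≤ pos b × pos b < s + length Z × blk b ≡ i) (numberInBlock s i Z)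
  numberInBlock-bounds s i [] = []
  numberInBlock-bounds s i (z ∷ Z) = (≤-refl , m<m+n s (s≤s z≤n) , refl) ∷
     All.map (λ {b} (a , c , d) → ≤-trans (n≤1+n s) a , subst (pos b <_) (sym (+-suc s (length Z))) c , d) (numberInBlock-bounds (suc s) i Z)

  numberInBlock-BlockOrder : ∀ s i Z → AllPairs (λ x y → proj₁ y ≤ proj₁ x) Z → AllPairs BlockOrder (numberInBlock s i Z)
  numberInBlock-BlockOrder s i [] [] = []
  numberInBlock-BlockOrder s i (z ∷ Z) (hz ∷ hZ) = later (suc s) Z hz (≤-refl) ∷ numberInBlock-BlockOrder (suc s) i Z hZ
    where later : ∀ t Z → All (λ y → proj₁ y ≤ proj₁ z) Z → s < t → All (BlockOrder (putLabel (s , i) z)) (numberInBlock t i Z)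
          later t [] [] _ = []
          later t (y ∷ Z) (h ∷ hs) lt = (lt , ≤-refl , (λ _ → h)) ∷ later (suc t) Z hs (≤-trans lt (n≤1+n t))

  doubleLabel-bounds : ∀ s i Zs → All (λ b → s ≤ pos b × i ≤ blk b) (doubleLabel s i Zs)
  doubleLabel-bounds s i [] = []
  doubleLabel-bounds s i (Zi ∷ Zs) = AllP.++⁺ (All.map (λ (a , _ , d) → a , ≤-reflexive (sym d)) (numberInBlock-bounds s i Zi))
     (All.map (λ (a , c) → ≤-trans (m≤m+n s (length Zi)) a , ≤-trans (n≤1+n i) c) (doubleLabel-bounds (s + length Zi) (suc i) Zs))

  doubleLabel-BlockOrder : ∀ s i Zs → All NoDescent Zs → AllPairs BlockOrder (doubleLabel s i Zs)
  doubleLabel-BlockOrder s i [] [] = []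
  doubleLabel-BlockOrder s i (Zi ∷ Zs) (nd ∷ nds) = APP.++⁺ (numberInBlock-BlockOrder s i Zi (LP.Linked⇒AllPairs (λ a b → ≤-trans b a) nd)) (doubleLabel-BlockOrder (s + length Zi) (suc i) Zs nds)
     (All.map (λ {x} (_ , c , d) → All.map (λ {y} (a' , c') → <-≤-trans c a' , subst (_≤ blk y) (sym d) (≤-trans (n≤1+n i) c') ,
              (λ e → ⊥-elim (<-irrefl (trans (sym d) e) (<-≤-trans (≤-refl) c'))))
        (doubleLabel-bounds (s + length Zi) (suc i) Zs)) (numberInBlock-bounds s i Zi))

  head-inRow : ∀ {L : Set} r (Q : List (L × ℕ × A)) {b} → head (inRow r Q) ≡ just b → b ∈ Q × rowOf b ≡ r
  head-inRow r Q {b} e = go (inRow r Q) refl e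
    where go : ∀ X → inRow r Q ≡ X → head X ≡ just b → b ∈ Q × rowOf b ≡ r
          go (x ∷ X) eX refl = let (m , t) = ∈-filter⁻ (T? ∘ _) {xs = Q} (subst (x ∈_) (sym eX) (here refl)) in m , ≡ᵇ⇒≡ (rowOf x) r t

  range-sorted : ∀ s m → AllPairs _<_ (range s m)
  range-sorted s zero = []
  range-sorted s (suc m) = above (suc s) m ≤-refl ∷ range-sorted (suc s) m
    where above : ∀ t m → s < t → All (s <_) (range t m)
          above t zero _ = []
          above t (suc m) lt = lt ∷ above (suc t) m (≤-trans lt (n≤1+n t))

  heads-properties : ∀ {L : Set} (Q : List (L × ℕ × A)) rs → AllPairs _<_ rs →
      AllPairs (λ x y → rowOf x < rowOf y) (mapMaybe (λ r → head (inRow r Q)) rs) ×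
      All (λ b → b ∈ Q × rowOf b ∈ rs) (mapMaybe (λ r → head (inRow r Q)) rs)
  heads-properties Q [] [] = [] , []
  heads-properties Q (r ∷ rs) (hr ∷ hs) with head (inRow r Q) in e
  ... | nothing = let (a , b) = heads-properties Q rs hs in a , All.map (λ (m , mr) → m , there mr) b
  ... | just x = let (a , b) = heads-properties Q rs hs ; (mx , rx) = head-inRow r Q e in
       All.map (λ {y} (_ , my) → subst (_< rowOf y) (sym rx) (All.lookup hr my)) b ∷ a ,
       (mx , here rx) ∷ All.map (λ (m , mr) → m , there mr) b

  heads-blocks-increasing : ∀ (Q : List ((ℕ × ℕ) × ℕ × A)) → AllPairs BlockOrder Q → ∀ H → Linked (λ x y → rowOf x < rowOf y) H → All (_∈ Q) H →
     Linked (λ x y → pos x < pos y) H → Linked (λ x y → blk x < blk y) H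
  heads-blocks-increasing Q ap [] _ _ _ = []
  heads-blocks-increasing Q ap (x ∷ []) _ _ _ = [-]
  heads-blocks-increasing Q ap (x ∷ y ∷ H) (rl ∷ rls) (mx ∷ my ∷ ms) (pl ∷ pls) = step (AllPairs-∈-trichotomy ap mx my) ∷ heads-blocks-increasing Q ap (y ∷ H) rls (my ∷ ms) pls
    where step : x ≡ y ⊎ BlockOrder x y ⊎ BlockOrder y x → blk x < blk y
          step (inj₁ refl) = ⊥-elim (<-irrefl refl pl)
          step (inj₂ (inj₁ (_ , b , c))) with m≤n⇒m<n∨m≡n b
          ... | inj₁ lt = lt
          ... | inj₂ eq = ⊥-elim (<-irrefl refl (<-≤-trans rl (c eq)))
          step (inj₂ (inj₂ (a , _ , _))) = ⊥-elim (<-asym a pl)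

  heads-positions-increasing : ∀ (Q : List ((ℕ × ℕ) × ℕ × A)) → AllPairs BlockOrder Q → ∀ H → All (_∈ Q) H →
     Linked (λ x y → blk x < blk y) H → Linked (λ x y → pos x < pos y) H
  heads-positions-increasing Q ap [] _ _ = []
  heads-positions-increasing Q ap (x ∷ []) _ _ = [-]
  heads-positions-increasing Q ap (x ∷ y ∷ H) (mx ∷ my ∷ ms) (bl ∷ bls) = step (AllPairs-∈-trichotomy ap mx my) ∷ heads-positions-increasing Q ap (y ∷ H) (my ∷ ms) bls
    where step : x ≡ y ⊎ BlockOrder x y ⊎ BlockOrder y x → pos x < pos y
          step (inj₁ refl) = ⊥-elim (<-irrefl refl bl)
          step (inj₂ (inj₁ (a , _ , _))) = a
          step (inj₂ (inj₂ (_ , b , _))) = ⊥-elim (<-irrefl refl (<-≤-trans bl b))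

foldr-⊔-max : ∀ (xs : List ℕ) m → All (_≤ m) xs → (m ≡ 0 ⊎ m ∈ xs) → foldr _⊔_ 0 xs ≡ m
foldr-⊔-max xs m ub h = ≤-antisym (foldr-⊔-≤ xs ub) (≥-foldr h)
  where
  foldr-⊔-≤ : ∀ xs → All (_≤ m) xs → foldr _⊔_ 0 xs ≤ m
  foldr-⊔-≤ [] [] = z≤n
  foldr-⊔-≤ (x ∷ xs) (u ∷ us) = ⊔-lub u (foldr-⊔-≤ xs us)
  ∈⇒≤-foldr-⊔ : ∀ xs {x} → x ∈ xs → x ≤ foldr _⊔_ 0 xs
  ∈⇒≤-foldr-⊔ (y ∷ xs) (here refl) = m≤m⊔n y _
  ∈⇒≤-foldr-⊔ (y ∷ xs) (there mx) = m≤n⇒m≤o⊔n y (∈⇒≤-foldr-⊔ xs mx)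
  ≥-foldr : (m ≡ 0 ⊎ m ∈ xs) → m ≤ foldr _⊔_ 0 xs
  ≥-foldr (inj₁ refl) = z≤n
  ≥-foldr (inj₂ mm) = ∈⇒≤-foldr-⊔ xs mm

module BlockLabels {A : Set} where
  open Boxes {A}
  open Build {A}

  dropLabel-putLabel : ∀ (i : ℕ) (Z : List (ℕ × A)) → map dropLabel (map (putLabel i) Z) ≡ Z
  dropLabel-putLabel i [] = refl
  dropLabel-putLabel i (z ∷ Z) = cong (z ∷_) (dropLabel-putLabel i Z)

  dropLabel-labelByBlock : ∀ i Zs → map dropLabel (labelByBlock i Zs) ≡ concat Zs
  dropLabel-labelByBlock i [] = refl
  dropLabel-labelByBlock i (Z ∷ Zs) = trans (map-++ dropLabel (map (putLabel i) Z) _) (cong₂ _++_ (dropLabel-putLabel i Z) (dropLabel-labelByBlock (suc i) Zs))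

  labelOf-putLabel : ∀ (i : ℕ) (Z : List (ℕ × A)) → All (λ b → labelOf b ≡ i) (map (putLabel i) Z)
  labelOf-putLabel i [] = []
  labelOf-putLabel i (z ∷ Z) = refl ∷ labelOf-putLabel i Z

  labelByBlock-bounds : ∀ i Zs → All (λ b → i ≤ labelOf b × labelOf b < i + length Zs) (labelByBlock i Zs)
  labelByBlock-bounds i [] = []
  labelByBlock-bounds i (Z ∷ Zs) = AllP.++⁺ (All.map (λ {b} e → ≤-reflexive (sym e) , subst (_< i + suc (length Zs)) (sym e) (m<m+n i (s≤s z≤n))) (labelOf-putLabel i Z))
      (All.map (λ {b} (a , c) → ≤-trans (n≤1+n i) a , subst (labelOf b <_) (sym (+-suc i (length Zs))) c) (labelByBlock-bounds (suc i) Zs))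

  labelByBlock-sorted : ∀ i Zs → AllPairs (λ x y → labelOf x ≤ labelOf y) (labelByBlock i Zs)
  labelByBlock-sorted i [] = []
  labelByBlock-sorted i (Z ∷ Zs) = APP.++⁺ (sameBlock Z) (labelByBlock-sorted (suc i) Zs)
      (All.map (λ {x} e → All.map (λ {y} (a , _) → subst (_≤ labelOf y) (sym e) (≤-trans (n≤1+n i) a)) (labelByBlock-bounds (suc i) Zs)) (labelOf-putLabel i Z))
    where sameBlock : ∀ Z → AllPairs (λ x y → labelOf x ≤ labelOf y) (map (putLabel i) Z)
          sameBlock [] = []
          sameBlock (z ∷ Z) = All.map (λ e → ≤-reflexive (sym e)) (labelOf-putLabel i Z) ∷ sameBlock Z

  labelByBlock-labels : ∀ i Zs → All (λ Z → ¬ Z ≡ []) Zs → All (λ j → j ∈ map labelOf (labelByBlock i Zs)) (range i (length Zs))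
  labelByBlock-labels i [] [] = []
  labelByBlock-labels i ([] ∷ Zs) (ne ∷ _) = ⊥-elim (ne refl)
  labelByBlock-labels i ((z ∷ Z) ∷ Zs) (_ ∷ nes) = here refl ∷
     All.map (λ {j} m → subst (j ∈_) (sym (map-++ labelOf (map (putLabel i) (z ∷ Z)) _)) (∈-++⁺ʳ (map labelOf (map (putLabel i) (z ∷ Z))) m)) (labelByBlock-labels (suc i) Zs nes)

  labelByBlock-blocks : ∀ {Y : Set} (F : List (ℕ × ℕ × A) → Y) (G : List (ℕ × A) → Y) i Zs →
     (∀ j {Z} → Z ∈ Zs → F (map (putLabel j) Z) ≡ G Z) →
     map (λ j → F (filterᵇ (λ b → labelOf b ≡ᵇ j) (labelByBlock i Zs))) (range i (length Zs)) ≡ map G Zs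
  labelByBlock-blocks F G i [] h = refl
  labelByBlock-blocks F G i (Z ∷ Zs) h = cong₂ _∷_ hd tl
    where
    hd : F (filterᵇ (λ b → labelOf b ≡ᵇ i) (map (putLabel i) Z ++ labelByBlock (suc i) Zs)) ≡ G Z
    hd = trans (cong F (trans (filter-++ (T? ∘ _) (map (putLabel i) Z) _)
            (trans (cong₂ _++_ (filter-all (T? ∘ _) (All.map (λ {b} e → ≡⇒≡ᵇ (labelOf b) i e) (labelOf-putLabel i Z)))
                               (filter-none (T? ∘ _) (All.map (λ {b} (a , _) t → <-irrefl (sym (≡ᵇ⇒≡ (labelOf b) i t)) a) (labelByBlock-bounds (suc i) Zs))))
             (++-identityʳ _)))) (h i (here refl))
    tl : map (λ j → F (filterᵇ (λ b → labelOf b ≡ᵇ j) (map (putLabel i) Z ++ labelByBlock (suc i) Zs))) (range (suc i) (length Zs)) ≡ map G Zs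
    tl = trans (map-cong-local (All.tabulate (λ {j} mj → cong F (trans (filter-++ (T? ∘ _) (map (putLabel i) Z) _)
            (cong (_++ filterᵇ (λ b → labelOf b ≡ᵇ j) (labelByBlock (suc i) Zs)) (filter-none (T? ∘ _) (All.map (λ {b} e t →
               <-irrefl (trans (sym e) (≡ᵇ⇒≡ (labelOf b) j t)) (proj₁ (∈-range⁻ (suc i) (length Zs) mj))) (labelOf-putLabel i Z))))))))
         (labelByBlock-blocks F G (suc i) Zs (λ j m → h j (there m)))

module TableauSide {A : Set} (_≟A_ : DecidableEquality A) (J B : Sentence A) where
  open Standardisation _≟A_ J B
  open Boxes {A}
  open Build {A}
  open FirstColumn {A}
  open BlockLabels {A}

  readingBoxes : Filling → List (ℕ × ℕ × A)
  readingBoxes T' = concat (reverse (tagRows 1 (colored J T')))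

  typeBlock : Filling → ℕ → List (ℕ × A)
  typeBlock T' i = map dropLabel (filterᵇ (λ b → labelOf b ≡ᵇ i) (readingBoxes T'))

  typeBlocks : Filling → List (List (ℕ × A))
  typeBlocks T' = map (typeBlock T') (vals m)

  dropRow-tagRows : ∀ s (CF : List (List (ℕ × A))) → map (map dropRow) (tagRows s CF) ≡ CF
  dropRow-tagRows s [] = refl
  dropRow-tagRows s (row ∷ CF) = cong₂ _∷_ (dropRow-putInRow s row) (dropRow-tagRows (suc s) CF)

  dropRow-readingBoxes : ∀ (CF : List (List (ℕ × A))) → map dropRow (concat (reverse (tagRows 1 CF))) ≡ concat (reverse CF)
  dropRow-readingBoxes CF = trans (sym (concat-map (reverse (tagRows 1 CF))))
     (cong concat (trans (reverse-map (map dropRow) (tagRows 1 CF)) (cong reverse (dropRow-tagRows 1 CF))))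

  typeWord≡typeBlock : ∀ T' i → typeWord J T' i ≡ map proj₂ (typeBlock T' i)
  typeWord≡typeBlock T' i = trans (typeWord≡ J T' i)
    (trans (cong (map proj₂ ∘ filterᵇ (λ p → proj₁ p ≡ᵇ i)) (sym (dropRow-readingBoxes (colored J T'))))
    (trans (cong (map proj₂) (filterᵇ-map _ dropRow (readingBoxes T')))
    (trans (sym (map-∘ (filterᵇ (λ b → labelOf b ≡ᵇ i) (readingBoxes T')))) (map-∘ (filterᵇ (λ b → labelOf b ≡ᵇ i) (readingBoxes T'))))))

  doubleLabelled : List (List (ℕ × A)) → List ((ℕ × ℕ) × ℕ × A)
  doubleLabelled Zs = doubleLabel 1 1 Zs

  standardFilling≡ : ∀ Zs → standardFilling Zs ≡ map (map proj₁) (labels (fillingOf k (doubleLabelled Zs)))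
  standardFilling≡ Zs = trans (cong (labels ∘ fillingOf k) (sym (doubleLabel-position 1 1 Zs))) (trans (cong labels (fillingOf-mapLabel proj₁ k (doubleLabelled Zs))) (labels-mapLabel proj₁ (fillingOf k (doubleLabelled Zs))))

  blockFilling≡ : ∀ Zs → blockFilling Zs ≡ map (map proj₂) (labels (fillingOf k (doubleLabelled Zs)))
  blockFilling≡ Zs = trans (cong (labels ∘ fillingOf k) (sym (doubleLabel-block 1 1 Zs))) (trans (cong labels (fillingOf-mapLabel proj₂ k (doubleLabelled Zs))) (labels-mapLabel proj₂ (fillingOf k (doubleLabelled Zs))))

  vals-increasing : AllPairs _<_ (vals k)
  vals-increasing = subst (AllPairs _<_) (sym (vals≡range k)) (range-sorted 1 k)

  firstColumn-standard⇒block : ∀ Zs → All NoDescent Zs → T (strictInc (firstColumn (standardFilling Zs))) → T (strictInc (firstColumn (blockFilling Zs)))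
  firstColumn-standard⇒block Zs nds t = subst (T ∘ strictInc) (sym (trans (cong firstColumn (blockFilling≡ Zs)) (firstColumn-heads proj₂ k (doubleLabelled Zs))))
     (Linked⇒strictInc (map blk H) (LP.map⁺ (heads-blocks-increasing (doubleLabelled Zs) (doubleLabel-BlockOrder 1 1 Zs nds) H (LP.AllPairs⇒Linked (proj₁ hp)) (All.map proj₁ (proj₂ hp))
        (LP.map⁻ (strictInc⇒Linked (map pos H) (subst (T ∘ strictInc) (trans (cong firstColumn (standardFilling≡ Zs)) (firstColumn-heads proj₁ k (doubleLabelled Zs))) t))))))
    where
    H = heads k (doubleLabelled Zs)
    hp = heads-properties (doubleLabelled Zs) (vals k) vals-increasing

  firstColumn-block⇒standard : ∀ Zs → All NoDescent Zs → T (strictInc (firstColumn (blockFilling Zs))) → T (strictInc (firstColumn (standardFilling Zs)))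
  firstColumn-block⇒standard Zs nds t = subst (T ∘ strictInc) (sym (trans (cong firstColumn (standardFilling≡ Zs)) (firstColumn-heads proj₁ k (doubleLabelled Zs))))
     (Linked⇒strictInc (map pos H) (LP.map⁺ (heads-positions-increasing (doubleLabelled Zs) (doubleLabel-BlockOrder 1 1 Zs nds) H (All.map proj₁ (proj₂ hp))
        (LP.map⁻ (strictInc⇒Linked (map blk H) (subst (T ∘ strictInc) (trans (cong firstColumn (blockFilling≡ Zs)) (firstColumn-heads proj₂ k (doubleLabelled Zs))) t))))))
    where
    H = heads k (doubleLabelled Zs)
    hp = heads-properties (doubleLabelled Zs) (vals k) vals-increasing

  runs-nonEmpty : ∀ (Zs : List (List (ℕ × A))) (B' : Sentence A) → map (map proj₂) Zs ≡ words B' → All (λ Z → ¬ Z ≡ []) Zs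
  runs-nonEmpty [] [] _ = []
  runs-nonEmpty (Z ∷ Zs) ((x ∷ xs) ∷ B') e =
    (λ { refl → ∷≢[]' (sym (proj₁ (∷-injective e))) }) ∷ runs-nonEmpty Zs B' (proj₂ (∷-injective e))
    where ∷≢[]' : ∀ {y : A} {l : List A} → ¬ _≡_ {A = List A} (y ∷ l) []
          ∷≢[]' ()
  runs-nonEmpty [] (_ ∷ _) ()
  runs-nonEmpty (_ ∷ _) [] ()

  module TableauFromBlocks (Zs : List (List (ℕ × A))) (G : Admissible Zs) where
    open Admissible G
    Qb = labelByBlock 1 Zs
    CFT = fillingOf k Qb
    T' = blockFilling Zs

    colours-rows : map (map proj₂) CFT ≡ words J
    colours-rows = trans (colours-fillingOf k Qb) (trans (cong (rowColours k) (dropLabel-labelByBlock 1 Zs)) rowColours≡J)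

    colored≡ : colored J T' ≡ CFT
    colored≡ = colored-labels J CFT colours-rows

    shape≡ : map length T' ≡ shape J
    shape≡ = shape-labels J CFT colours-rows

    length-runs : length Zs ≡ m
    length-runs = trans (sym (length-map (map proj₂) Zs)) (trans (cong length colours≡B) (length-map _ B))

    entries-bounded : All (All (InVals m)) T'
    entries-bounded = All-labels-fillingOf (InVals m) k Qb (AllP.map⁺ (All.map (λ {b} (a , c) → a , ≤-pred (subst (labelOf b <_) (cong suc length-runs) c)) (labelByBlock-bounds 1 Zs)))

    enumerated : T' ∈ fillingsUpTo m (shape J)
    enumerated = ∈-fillingsUpTo⁺ m (shape J) T' shape≡ entries-bounded

    immaculate : T (isImmaculate T')
    immaculate = T-∧⁺ (All⇒allᵇ weakInc T' (fillingOf-rows-weakInc k Qb (labelByBlock-sorted 1 Zs))) (firstColumn-standard⇒block Zs descentFree firstColumn-increasing)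

    rowFibres : List (ℕ × ℕ × A) → List (List (ℕ × ℕ × A))
    rowFibres X = map (λ r → inRow r X) (vals k)

    readingBoxes≡ : readingBoxes T' ≡ concat (reverse (rowFibres Qb))
    readingBoxes≡ = trans (cong (λ CF → concat (reverse (tagRows 1 CF))) colored≡)
       (cong (concat ∘ reverse) (trans (cong (λ l → tagRows 1 (map (λ r → map dropRow (inRow r Qb)) l)) (vals≡range k))
         (trans (tagRows-fillingOf 1 k Qb) (cong (λ l → map (λ r → inRow r Qb) l) (sym (vals≡range k))))))

    filter-readingBoxes : ∀ i → filterᵇ (λ b → labelOf b ≡ᵇ i) (concat (reverse (rowFibres Qb))) ≡ concat (reverse (rowFibres (filterᵇ (λ b → labelOf b ≡ᵇ i) Qb)))
    filter-readingBoxes i = trans (filterᵇ-concat _ (reverse (rowFibres Qb)))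
       (cong concat (trans (reverse-map (filterᵇ (λ b → labelOf b ≡ᵇ i)) (rowFibres Qb))
          (cong reverse (trans (sym (map-∘ (vals k))) (map-cong-local (All.tabulate (λ {r} _ → filterᵇ-comm _ _ Qb)))))))

    readUpward : List (ℕ × ℕ × A) → List (ℕ × A)
    readUpward X = map dropLabel (concat (reverse (rowFibres X)))

    readUpward-run : ∀ j {Z} → Z ∈ Zs → readUpward (map (putLabel j) Z) ≡ Z
    readUpward-run j {Z} mZ = trans (cong (map dropLabel) (trans (cong concat (sym (reverse-map (λ r → inRow r X) (vals k))))
         (trans (cong (λ l → concat (map (λ r → inRow r X) (reverse l))) (vals≡range k))
         (Fibres.fibres-range-descending rowOf 1 k X ap bnd)))) (dropLabel-putLabel j Z)
      where
      X = map (putLabel j) Z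
      ap : AllPairs (λ x y → rowOf y ≤ rowOf x) X
      ap = APP.map⁺ (LP.Linked⇒AllPairs (λ a b → ≤-trans b a) (All.lookup descentFree mZ))
      bnd : All (λ x → 1 ≤ rowOf x × rowOf x < 1 + k) X
      bnd = AllP.map⁺ (All.tabulate {xs = Z} (λ {z} mz → let (a , c) = ∈-vals⁻ k (All.lookup rows∈vals (∈-concat⁺′ mz mZ)) in a , s≤s c))

    typeBlocks≡runs : typeBlocks T' ≡ Zs
    typeBlocks≡runs = trans (map-cong-local (All.tabulate (λ {i} _ → cong (map dropLabel) (trans (cong (filterᵇ (λ b → labelOf b ≡ᵇ i)) readingBoxes≡) (filter-readingBoxes i)))))
      (trans (cong (λ l → map (λ i → readUpward (filterᵇ (λ b → labelOf b ≡ᵇ i) Qb)) l) (trans (vals≡range m) (cong (range 1) (sym length-runs))))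
      (trans (labelByBlock-blocks readUpward id 1 Zs readUpward-run) (map-id Zs)))

    Lst = concat (rowFibres Qb)
    fibres-↭-boxes : Lst ↭ Qb
    fibres-↭-boxes = Fibres.fibres-↭ rowOf Qb (vals k) rows∈vals′ (vals-unique k)
      where
      rows∈vals′ : All (λ b → rowOf b ∈ vals k) Qb
      rows∈vals′ = AllP.map⁻ (subst (All (λ z → proj₁ z ∈ vals k)) (sym (dropLabel-labelByBlock 1 Zs)) rows∈vals)

    maxEntry≡ : maxEntry T' ≡ m
    maxEntry≡ = trans (cong (foldr _⊔_ 0) (concat-labels-fillingOf k Qb))
       (foldr-⊔-max (map labelOf Lst) m (All-resp-↭ (↭-sym (map⁺ labelOf fibres-↭-boxes)) ub) mem)
      where
      ub : All (_≤ m) (map labelOf Qb)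
      ub = AllP.map⁺ (All.map (λ {b} (_ , c) → ≤-pred (subst (labelOf b <_) (cong suc length-runs) c)) (labelByBlock-bounds 1 Zs))
      mem : m ≡ 0 ⊎ m ∈ map labelOf Lst
      mem with m | length-runs
      ... | zero | _ = inj₁ refl
      ... | suc m' | e = inj₂ (∈-resp-↭ (↭-sym (map⁺ labelOf fibres-↭-boxes))
              (All.lookup (labelByBlock-labels 1 Zs (runs-nonEmpty Zs B colours≡B)) (subst (suc m' ∈_) (cong (range 1) (sym e)) (∈-range⁺ 1 (suc m') (s≤s z≤n) ≤-refl))))

    type≡B : typeOf J T' ≡ words B
    type≡B = trans (cong (λ N → map (typeWord J T') (vals N)) maxEntry≡)
      (trans (map-cong-local (All.tabulate (λ {i} _ → typeWord≡typeBlock T' i)))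
      (trans (map-∘ (vals m)) (trans (cong (map (map proj₂)) typeBlocks≡runs) colours≡B)))

    tableauFromBlocks : T' ∈ fillingsUpTo m (shape J) × T (isTableauOfType T') × typeBlocks T' ≡ Zs
    tableauFromBlocks = enumerated , T-∧⁺ immaculate (subst (λ t → T (same t (words B))) (sym type≡B) (same-refl (words B))) , typeBlocks≡runs

splitAt-lengths : ∀ {X : Set} → List ℕ → List X → List (List X)
splitAt-lengths [] Z = []
splitAt-lengths (l ∷ ls) Z = take l Z ∷ splitAt-lengths ls (drop l Z)

take-length-++ : ∀ {X : Set} (Z R : List X) → take (length Z) (Z ++ R) ≡ Z
take-length-++ [] R = refl
take-length-++ (x ∷ Z) R = cong (x ∷_) (take-length-++ Z R)

drop-length-++ : ∀ {X : Set} (Z R : List X) → drop (length Z) (Z ++ R) ≡ R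
drop-length-++ [] R = refl
drop-length-++ (x ∷ Z) R = drop-length-++ Z R

splitAt-lengths-concat : ∀ {X : Set} (Zs : List (List X)) → splitAt-lengths (map length Zs) (concat Zs) ≡ Zs
splitAt-lengths-concat [] = refl
splitAt-lengths-concat (Z ∷ Zs) = cong₂ _∷_ (take-length-++ Z (concat Zs)) (trans (cong (splitAt-lengths (map length Zs)) (drop-length-++ Z (concat Zs))) (splitAt-lengths-concat Zs))

module StandardToBlocks {A : Set} (_≟A_ : DecidableEquality A) (J B : Sentence A) where
  open Standardisation _≟A_ J B
  open TableauSide _≟A_ J B
  open Boxes {A}
  open Build {A}

  lengthsB : List ℕ
  lengthsB = map length (words B)

  destandardise : Filling → Filling
  destandardise U = blockFilling (splitAt-lengths lengthsB (readByEntry J U))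

  standardise : Filling → Filling
  standardise T' = standardFilling (typeBlocks T')

  labels-tagRows : ∀ s (CF : List (List (ℕ × A))) → map labelOf (concat (tagRows s CF)) ≡ concat (labels CF)
  labels-tagRows s [] = refl
  labels-tagRows s (row ∷ CF) = trans (map-++ labelOf (map (putInRow s) row) _) (cong₂ _++_ (sym (map-∘ row)) (labels-tagRows (suc s) CF))

  inRow-sorted : ∀ s (CF : List (List (ℕ × A))) → All (λ row → AllPairs _≤_ row) (labels CF) → ∀ r →
     AllPairs (λ x y → labelOf x ≤ labelOf y) (inRow r (concat (tagRows s CF)))
  inRow-sorted s [] _ r = []
  inRow-sorted s (row ∷ CF) (h ∷ hs) r with s ℕ.≟ r
  ... | yes refl = subst (AllPairs (λ x y → labelOf x ≤ labelOf y)) (sym (trans (filter-++ (T? ∘ _) (map (putInRow s) row) _)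
          (trans (cong₂ _++_ (inRow-putInRow s row) (inRow-none s _ (All.map (λ le e → <-irrefl (sym e) le) (tagRows-rows≥ (suc s) CF)))) (++-identityʳ _))))
          (APP.map⁻ {f = labelOf} h')
    where h' : AllPairs _≤_ (map proj₁ (map (putInRow s) row))
          h' = subst (AllPairs _≤_) (map-∘ {g = proj₁} {f = putInRow {ℕ} s} row) h
  ... | no ne = subst (AllPairs (λ x y → labelOf x ≤ labelOf y)) (sym (trans (filter-++ (T? ∘ _) (map (putInRow s) row) _)
          (cong (_++ inRow r (concat (tagRows (suc s) CF))) (inRow-putInRow-≢ r s row ne)))) (inRow-sorted (suc s) CF hs r)

  length≡1 : ∀ {X : Set} (xs : List X) → length xs ≡ 1 → ∃ λ x → xs ≡ x ∷ []
  length≡1 (x ∷ []) refl = x , refl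

  putLabel-dropLabel : ∀ (x : ℕ × ℕ × A) s → labelOf x ≡ s → putLabel s (dropLabel x) ≡ x
  putLabel-dropLabel (l , r , c) s refl = refl

  module BlocksOfStandard (U : Filling) (mU : U ∈ fillingsUpTo n (shape J)) (pU : T (isStandardOfCoarsening U)) where
    shape≡ : map length U ≡ shape J
    shape≡ = proj₁ (∈-fillingsUpTo⁻ n (shape J) mU)
    entries-bounded : All (All (InVals n)) U
    entries-bounded = proj₂ (∈-fillingsUpTo⁻ n (shape J) mU)
    coB = anyᵇ (λ C → same (descentComposition J U) (words C)) (coarsenings B)
    immaculate : T (isImmaculate U)
    immaculate = T-∧ˡ {isImmaculate U} {isStandard J U ∧ coB} pU
    standard : T (isStandard J U)
    standard = T-∧ˡ {isStandard J U} {coB} (T-∧ʳ {isImmaculate U} {isStandard J U ∧ coB} pU)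
    coarsens-B : T coB
    coarsens-B = T-∧ʳ {isStandard J U} {coB} (T-∧ʳ {isImmaculate U} {isStandard J U ∧ coB} pU)

    CF = colored J U
    Lst = concat (tagRows 1 CF)
    Z = readByEntry J U
    boxesWith : ℕ → List (ℕ × ℕ × A)
    boxesWith v = filterᵇ (λ b → labelOf b ≡ᵇ v) Lst

    length-colored : length CF ≡ k
    length-colored = trans (sym (length-map (map proj₂) CF)) (trans (cong length (colours-colored J U shape≡)) (length-words J))

    labels-boxes : map labelOf Lst ≡ concat U
    labels-boxes = trans (labels-tagRows 1 CF) (cong concat (labels-colored J U shape≡))

    count≡1 : ∀ v → v ∈ vals n → length (boxesWith v) ≡ 1
    count≡1 v mv = trans (sym (length-map labelOf (boxesWith v))) (trans (cong length (sym (filterᵇ-map _ labelOf Lst)))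
       (trans (cong (length ∘ filterᵇ (λ x → x ≡ᵇ v)) labels-boxes)
        (≡ᵇ⇒≡ _ 1 (All.lookup (allᵇ⇒All _ (vals n) standard) mv))))

    readByEntry-fibres : ∀ vs → All (λ v → v ∈ vals n) vs → mapMaybe (λ v → findEntry v Lst) vs ≡ map dropLabel (concat (map boxesWith vs))
    readByEntry-fibres [] [] = refl
    readByEntry-fibres (v ∷ vs) (mv ∷ ms) with length≡1 (boxesWith v) (count≡1 v mv)
    ... | x , e = trans (mapMaybe-∷-just _ v vs (trans (findEntry≡ v Lst) (cong (Maybe.map dropLabel ∘ head) e)))
       (trans (cong (dropLabel x ∷_) (readByEntry-fibres vs ms)) (cong (λ l → map dropLabel (l ++ concat (map boxesWith vs))) (sym e)))

    reading≡fibres : Z ≡ map dropLabel (concat (map boxesWith (vals n)))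
    reading≡fibres = trans (cong (λ L → mapMaybe (λ v → findEntry v L) (vals n)) (withRows≡concat-tagRows 1 CF)) (readByEntry-fibres (vals n) (All.tabulate {xs = vals n} id))

    numberFrom-fibres : ∀ s N → All (λ v → v ∈ vals n) (range s N) → numberFrom s (map dropLabel (concat (map boxesWith (range s N)))) ≡ concat (map boxesWith (range s N))
    numberFrom-fibres s zero _ = refl
    numberFrom-fibres s (suc N) (mv ∷ ms) with length≡1 (boxesWith s) (count≡1 s mv)
    ... | x , e = trans (cong (λ l → numberFrom s (map dropLabel (l ++ concat (map boxesWith (range (suc s) N))))) e)
        (trans (cong₂ _∷_ (putLabel-dropLabel x s (≡ᵇ⇒≡ (labelOf x) s (proj₂ (∈-filter⁻ (T? ∘ _) {xs = Lst} (subst (x ∈_) (sym e) (here refl)))))) (numberFrom-fibres (suc s) N ms))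
          (cong (_++ concat (map boxesWith (range (suc s) N))) (sym e)))

    S = concat (map boxesWith (vals n))

    numberFrom-reading : numberFrom 1 Z ≡ S
    numberFrom-reading = trans (cong (numberFrom 1) reading≡fibres) (trans (cong (λ l → numberFrom 1 (map dropLabel (concat (map boxesWith l)))) (vals≡range n))
       (trans (numberFrom-fibres 1 n (subst (All (λ v → v ∈ vals n)) (vals≡range n) (All.tabulate {xs = vals n} id)))
              (cong (λ l → concat (map boxesWith l)) (sym (vals≡range n)))))

    rows-sorted : All (λ row → AllPairs _≤_ row) (labels CF)
    rows-sorted = subst (All (λ row → AllPairs _≤_ row)) (sym (labels-colored J U shape≡))
       (All.map (λ {row} t → LP.Linked⇒AllPairs ≤-trans (weakInc⇒Linked row t)) (allᵇ⇒All weakInc U (T-∧ˡ {allᵇ weakInc U} {strictInc (firstColumn U)} immaculate)))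

    label-bounds : All (λ b → 1 ≤ labelOf b × labelOf b < 1 + n) Lst
    label-bounds = AllP.map⁻ (subst (All (λ x → 1 ≤ x × x < 1 + n)) (sym labels-boxes)
       (All.map (λ (a , c) → a , s≤s c) (AllP.concat⁺ entries-bounded)))

    inRow-fibres : ∀ r → inRow r S ≡ inRow r Lst
    inRow-fibres r = trans (filterᵇ-concat _ (map boxesWith (vals n)))
       (trans (cong concat (trans (sym (map-∘ (vals n))) (map-cong-local (All.tabulate (λ {v} _ → filterᵇ-comm _ _ Lst)))))
       (trans (cong (λ l → concat (map (λ v → filterᵇ (λ b → labelOf b ≡ᵇ v) (inRow r Lst)) l)) (vals≡range n))
       (Fibres.fibres-range-ascending labelOf 1 n (inRow r Lst) (inRow-sorted 1 CF rows-sorted r)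
          (All.tabulate (λ {b} mb → All.lookup label-bounds (proj₁ (∈-filter⁻ (T? ∘ _) {xs = Lst} mb)))))))

    fillingOf-fibres : fillingOf k S ≡ CF
    fillingOf-fibres = trans (map-cong-local (All.tabulate (λ {r} _ → cong (map dropRow) (inRow-fibres r))))
       (trans (cong (λ L → fillingOf k L) (sym (withRows≡concat-tagRows 1 CF)))
       (trans (cong (λ K → fillingOf K (withRows 1 CF)) (sym length-colored)) (fillingOf-withRows CF)))

    cutDescents∈ : cutDescents Z ∈ coarseningWords B
    cutDescents∈ with anyᵇ⁻ _ (coarsenings B) coarsens-B
    ... | C , mC , t = subst (_∈ coarseningWords B) (sym (same-sound _ _ t)) (∈-map⁺ words mC)

    cdm = blocks-of-cutDescents B Z cutDescents∈
    Zs' = proj₁ cdm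
    e1 : concat Zs' ≡ Z
    e1 = proj₁ (proj₂ cdm)
    e2 : map (map proj₂) Zs' ≡ words B
    e2 = proj₁ (proj₂ (proj₂ cdm))
    nds : All NoDescent Zs'
    nds = proj₂ (proj₂ (proj₂ cdm))

    Zs = splitAt-lengths lengthsB Z

    runs≡ : Zs ≡ Zs'
    runs≡ = trans (cong₂ splitAt-lengths (trans (cong (map length) (sym e2)) (trans (sym (map-∘ Zs')) (map-cong-local (All.tabulate (λ {Y} _ → length-map proj₂ Y))))) (sym e1))
       (splitAt-lengths-concat Zs')

    concat-runs : concat Zs ≡ Z
    concat-runs = trans (cong concat runs≡) e1

    standardFilling≡U : standardFilling Zs ≡ U
    standardFilling≡U = trans (cong (labels ∘ fillingOf k) (trans (cong (numberFrom 1) concat-runs) numberFrom-reading)) (trans (cong labels fillingOf-fibres) (labels-colored J U shape≡))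

    admissible : Admissible Zs
    admissible = record
      { colours≡B = subst (λ X → map (map proj₂) X ≡ words B) (sym runs≡) e2
      ; descentFree = subst (All NoDescent) (sym runs≡) nds
      ; rows∈vals = subst (All (λ z → proj₁ z ∈ vals k)) (sym (trans concat-runs reading≡fibres)) rows∈vals′
      ; rowColours≡J = trans (cong (rowColours k) (trans concat-runs reading≡fibres)) (trans (sym (colours-fillingOf k S)) (trans (cong (map (map proj₂)) fillingOf-fibres) (colours-colored J U shape≡)))
      ; firstColumn-increasing = subst (T ∘ strictInc ∘ firstColumn) (sym standardFilling≡U) (T-∧ʳ {allᵇ weakInc U} {strictInc (firstColumn U)} immaculate)
      }
      where
      rows∈vals-boxes : All (λ b → rowOf b ∈ vals k) Lst
      rows∈vals-boxes = All.zipWith {P = λ b → 1 ≤ rowOf b} {Q = λ b → rowOf b < 1 + length CF} (λ {b} (a , c) → ∈-vals⁺ k (a , ≤-pred (subst (rowOf b <_) (cong suc length-colored) c))) (tagRows-rows≥ 1 CF , tagRows-rows< 1 CF)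
      rows∈vals′ : All (λ z → proj₁ z ∈ vals k) (map dropLabel S)
      rows∈vals′ = AllP.map⁺ (All.tabulate {xs = S} (λ {b} mb → let (ys , mx , my) = ∈-concat⁻′ (map boxesWith (vals n)) mb ; (v , _ , ey) = ∈-map⁻ boxesWith my
                                           in All.lookup rows∈vals-boxes (proj₁ (∈-filter⁻ (T? ∘ _) {xs = Lst} (subst (b ∈_) ey mx)))))

    blocksOfStandard : Admissible Zs × standardFilling Zs ≡ U
    blocksOfStandard = admissible , standardFilling≡U

∈-concat-reverse : ∀ {X : Set} (xss : List (List X)) {x} → x ∈ concat (reverse xss) → x ∈ concat xss
∈-concat-reverse xss m = let (ys , mx , my) = ∈-concat⁻′ (reverse xss) m in ∈-concat⁺′ mx (Any.reverse⁻ {xs = xss} my)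

module TableauToBlocks {A : Set} (_≟A_ : DecidableEquality A) (J B : Sentence A) where
  open Standardisation _≟A_ J B
  open TableauSide _≟A_ J B
  open StandardToBlocks _≟A_ J B
  open Boxes {A}
  open Build {A}
  open BlockLabels {A}

  readingBoxes-rows-descending : ∀ s (CF : List (List (ℕ × A))) → AllPairs (λ x y → rowOf y ≤ rowOf x) (concat (reverse (tagRows s CF)))
  readingBoxes-rows-descending s [] = []
  readingBoxes-rows-descending s (row ∷ CF) = subst (AllPairs (λ x y → rowOf y ≤ rowOf x)) (sym (concat-reverse-∷ (map (putInRow s) row) (tagRows (suc s) CF)))
    (APP.++⁺ (readingBoxes-rows-descending (suc s) CF) (tagged row)
      (All.tabulate (λ {x} mx → All.map (λ e → subst (_≤ rowOf x) (sym e) (≤-trans (n≤1+n s) (All.lookup (tagRows-rows≥ (suc s) CF) (∈-concat-reverse (tagRows (suc s) CF) mx)))) (tagRow row))))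
    where
    tagRow : ∀ (row : List (ℕ × A)) → All (λ b → rowOf b ≡ s) (map (putInRow s) row)
    tagRow [] = []
    tagRow (x ∷ row) = refl ∷ tagRow row
    tagged : ∀ (row : List (ℕ × A)) → AllPairs (λ x y → rowOf y ≤ rowOf x) (map (putInRow s) row)
    tagged [] = []
    tagged (x ∷ row) = All.map (λ e → ≤-reflexive e) (tagRow row) ∷ tagged row

  labelByBlock-fibres : ∀ (G : ℕ → List (ℕ × ℕ × A)) s N → (∀ i → All (λ b → labelOf b ≡ i) (G i)) →
     labelByBlock s (map (λ i → map dropLabel (G i)) (range s N)) ≡ concat (map G (range s N))
  labelByBlock-fibres G s zero h = refl
  labelByBlock-fibres G s (suc N) h = cong₂ _++_ (putLabel-dropLabel-all (G s) (h s)) (labelByBlock-fibres G (suc s) N h)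
    where putLabel-dropLabel-all : ∀ X → All (λ b → labelOf b ≡ s) X → map (putLabel s) (map dropLabel X) ≡ X
          putLabel-dropLabel-all [] [] = []'
            where []' = refl
          putLabel-dropLabel-all (x ∷ X) (e ∷ es) = cong₂ _∷_ (putLabel-dropLabel x s e) (putLabel-dropLabel-all X es)

  module BlocksOfTableau (T' : Filling) (mT : T' ∈ fillingsUpTo m (shape J)) (pT : T (isTableauOfType T')) where
    shape≡ : map length T' ≡ shape J
    shape≡ = proj₁ (∈-fillingsUpTo⁻ m (shape J) mT)
    entries-bounded : All (All (InVals m)) T'
    entries-bounded = proj₂ (∈-fillingsUpTo⁻ m (shape J) mT)
    immaculate : T (isImmaculate T')
    immaculate = T-∧ˡ {isImmaculate T'} {same (typeOf J T') (words B)} pT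
    type≡B : typeOf J T' ≡ words B
    type≡B = same-sound _ _ (T-∧ʳ {isImmaculate T'} {same (typeOf J T') (words B)} pT)

    CF = colored J T'
    Lst = concat (tagRows 1 CF)
    Qb' = readingBoxes T'
    boxesWithEntry : ℕ → List (ℕ × ℕ × A)
    boxesWithEntry i = filterᵇ (λ b → labelOf b ≡ᵇ i) Qb'
    Zs = typeBlocks T'

    length-colored : length CF ≡ k
    length-colored = trans (sym (length-map (map proj₂) CF)) (trans (cong length (colours-colored J T' shape≡)) (length-words J))

    maxEntry≡ : maxEntry T' ≡ m
    maxEntry≡ = trans (sym (trans (length-map (typeWord J T') (vals (maxEntry T'))) (length-applyUpTo suc (maxEntry T'))))
       (trans (cong length type≡B) (length-map _ B))

    colours≡B′ : map (map proj₂) Zs ≡ words B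
    colours≡B′ = trans (sym (map-∘ (vals m))) (trans (map-cong-local (All.tabulate (λ {i} _ → sym (typeWord≡typeBlock T' i))))
      (trans (cong (λ N → map (typeWord J T') (vals N)) (sym maxEntry≡)) type≡B))

    descentFree′ : All NoDescent Zs
    descentFree′ = AllP.map⁺ (All.tabulate {xs = vals m} (λ {i} _ → LP.AllPairs⇒Linked (APP.map⁺ (APP.filter⁺ (T? ∘ (λ b → labelOf b ≡ᵇ i)) (readingBoxes-rows-descending 1 CF)))))

    rows∈vals-boxes : All (λ b → rowOf b ∈ vals k) Lst
    rows∈vals-boxes = All.zipWith {P = λ b → 1 ≤ rowOf b} {Q = λ b → rowOf b < 1 + length CF} (λ {b} (a , c) → ∈-vals⁺ k (a , ≤-pred (subst (rowOf b <_) (cong suc length-colored) c))) (tagRows-rows≥ 1 CF , tagRows-rows< 1 CF)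

    S = concat (map boxesWithEntry (vals m))

    labelByBlock≡fibres : labelByBlock 1 Zs ≡ S
    labelByBlock≡fibres = trans (cong (λ l → labelByBlock 1 (map (λ i → map dropLabel (boxesWithEntry i)) l)) (vals≡range m))
       (trans (labelByBlock-fibres boxesWithEntry 1 m (λ i → All.tabulate {xs = boxesWithEntry i} (λ {b} mb → ≡ᵇ⇒≡ (labelOf b) i (proj₂ (∈-filter⁻ (T? ∘ _) {xs = Qb'} mb)))))
       (cong (λ l → concat (map boxesWithEntry l)) (sym (vals≡range m))))

    labels-boxes : map labelOf Lst ≡ concat T'
    labels-boxes = trans (labels-tagRows 1 CF) (cong concat (labels-colored J T' shape≡))

    rows-sorted : All (λ row → AllPairs _≤_ row) (labels CF)
    rows-sorted = subst (All (λ row → AllPairs _≤_ row)) (sym (labels-colored J T' shape≡))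
       (All.map (λ {row} t → LP.Linked⇒AllPairs ≤-trans (weakInc⇒Linked row t)) (allᵇ⇒All weakInc T' (T-∧ˡ {allᵇ weakInc T'} {strictInc (firstColumn T')} immaculate)))

    label-bounds : All (λ b → 1 ≤ labelOf b × labelOf b < 1 + m) Lst
    label-bounds = AllP.map⁻ (subst (All (λ x → 1 ≤ x × x < 1 + m)) (sym labels-boxes)
       (All.map (λ (a , c) → a , s≤s c) (AllP.concat⁺ entries-bounded)))

    inRow-fibres : ∀ r → inRow r S ≡ inRow r Lst
    inRow-fibres r = trans (filterᵇ-concat _ (map boxesWithEntry (vals m)))
       (trans (cong concat (trans (sym (map-∘ (vals m))) (map-cong-local (All.tabulate (λ {v} _ → trans (filterᵇ-comm _ _ Qb') (cong (filterᵇ (λ b → labelOf b ≡ᵇ v)) (sym (inRow-concat-reverse 1 CF r))))))))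
       (trans (cong (λ l → concat (map (λ v → filterᵇ (λ b → labelOf b ≡ᵇ v) (inRow r Lst)) l)) (vals≡range m))
       (Fibres.fibres-range-ascending labelOf 1 m (inRow r Lst) (inRow-sorted 1 CF rows-sorted r)
          (All.tabulate (λ {b} mb → All.lookup label-bounds (proj₁ (∈-filter⁻ (T? ∘ _) {xs = Lst} mb)))))))

    fillingOf-fibres : fillingOf k S ≡ CF
    fillingOf-fibres = trans (map-cong-local (All.tabulate (λ {r} _ → cong (map dropRow) (inRow-fibres r))))
       (trans (cong (λ L → fillingOf k L) (sym (withRows≡concat-tagRows 1 CF)))
       (trans (cong (λ K → fillingOf K (withRows 1 CF)) (sym length-colored)) (fillingOf-withRows CF)))

    blockFilling≡T : blockFilling Zs ≡ T'
    blockFilling≡T = trans (cong (labels ∘ fillingOf k) labelByBlock≡fibres) (trans (cong labels fillingOf-fibres) (labels-colored J T' shape≡))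

    concat-runs : concat Zs ≡ map dropLabel S
    concat-runs = trans (sym (dropLabel-labelByBlock 1 Zs)) (cong (map dropLabel) labelByBlock≡fibres)

    rows∈vals′ : All (λ z → proj₁ z ∈ vals k) (concat Zs)
    rows∈vals′ = subst (All (λ z → proj₁ z ∈ vals k)) (sym concat-runs)
       (AllP.map⁺ (All.tabulate {xs = S} (λ {b} mb → let (ys , mx , my) = ∈-concat⁻′ (map boxesWithEntry (vals m)) mb ; (v , _ , ey) = ∈-map⁻ boxesWithEntry my
                      in All.lookup rows∈vals-boxes (∈-concat-reverse (tagRows 1 CF) (proj₁ (∈-filter⁻ (T? ∘ _) {xs = Qb'} (subst (b ∈_) ey mx)))))))

    admissible : Admissible Zs
    admissible = record
      { colours≡B = colours≡B′
      ; descentFree = descentFree′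
      ; rows∈vals = rows∈vals′
      ; rowColours≡J = trans (cong (rowColours k) concat-runs) (trans (sym (colours-fillingOf k S)) (trans (cong (map (map proj₂)) fillingOf-fibres) (colours-colored J T' shape≡)))
      ; firstColumn-increasing = firstColumn-block⇒standard Zs descentFree′ (subst (T ∘ strictInc ∘ firstColumn) (sym blockFilling≡T) (T-∧ʳ {allᵇ weakInc T'} {strictInc (firstColumn T')} immaculate))
      }

    blocksOfTableau : Admissible Zs × blockFilling Zs ≡ T'
    blocksOfTableau = admissible , blockFilling≡T

module Bijection {A : Set} (_≟A_ : DecidableEquality A) (J B : Sentence A) where
  open Standardisation _≟A_ J B
  open TableauSide _≟A_ J B
  open StandardToBlocks _≟A_ J B
  open TableauToBlocks _≟A_ J B
  open Boxes {A}
  open Build {A}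

  lengthsB≡ : ∀ (Zs : List (List (ℕ × A))) → map (map proj₂) Zs ≡ words B → lengthsB ≡ map length Zs
  lengthsB≡ Zs e = trans (cong (map length) (sym e)) (trans (sym (map-∘ Zs)) (map-cong-local (All.tabulate (λ {Y} _ → length-map proj₂ Y))))

  destandardise-correct : ∀ {U} → U ∈ fillingsUpTo n (shape J) → T (isStandardOfCoarsening U) → destandardise U ∈ fillingsUpTo m (shape J) × T (isTableauOfType (destandardise U)) × standardise (destandardise U) ≡ U
  destandardise-correct {U} mU pU = proj₁ bk , proj₁ (proj₂ bk) , trans (cong standardFilling (proj₂ (proj₂ bk))) (proj₂ el)
    where
    el = BlocksOfStandard.blocksOfStandard U mU pU
    bk = TableauFromBlocks.tableauFromBlocks (BlocksOfStandard.Zs U mU pU) (proj₁ el)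

  standardise-correct : ∀ {T'} → T' ∈ fillingsUpTo m (shape J) → T (isTableauOfType T') → standardise T' ∈ fillingsUpTo n (shape J) × T (isStandardOfCoarsening (standardise T')) × destandardise (standardise T') ≡ T'
  standardise-correct {T'} mT pT = proj₁ bl , proj₁ (proj₂ bl) ,
        trans (cong (λ Z → blockFilling (splitAt-lengths lengthsB Z)) (proj₂ (proj₂ bl)))
          (trans (cong (λ l → blockFilling (splitAt-lengths l (concat (typeBlocks T')))) (lengthsB≡ (typeBlocks T') (Admissible.colours≡B (proj₁ ek))))
          (trans (cong blockFilling (splitAt-lengths-concat (typeBlocks T'))) (proj₂ ek)))
    where
    ek = BlocksOfTableau.blocksOfTableau T' mT pT
    bl = StandardFromBlocks.standardFromBlocks (typeBlocks T') (proj₁ ek)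

proposition4p24 : (k : ℕ) (J B : Sentence (Fin k)) →
    Kcount _≟_ J B ≡ sum (map (Lcount _≟_ J) (coarsenings B))
proposition4p24 k J B = begin
    Kcount _≟_ J B
  ≡⟨ count-≡-by-bijection (fillingsUpTo m (shape J)) (fillingsUpTo n (shape J)) isTableauOfType isStandardOfCoarsening
       (fillingsUpTo-unique m (shape J)) (fillingsUpTo-unique n (shape J))
       standardise destandardise standardise-correct destandardise-correct ⟩
    length (filterᵇ isStandardOfCoarsening (fillingsUpTo n (shape J)))
  ≡⟨ sum-count≡count-any isImmaculate (isStandard J) (descentComposition J) words same same-sound
       (fillingsUpTo n (shape J)) (coarsenings B) (coarseningWords-unique B) ⟨
    sum (map (Lcount _≟_ J) (coarsenings B))
  ∎
  where
  open ≡-Reasoning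
  open Standardisation _≟_ J B
  open StandardToBlocks _≟_ J B
  open Bijection _≟_ J B
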